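{- Let $G_n^{T}$ denote the flip graph of triangulations of a convex $n$-gon (defined in the context). Then: (i) if $n\geq 4$, then $G_n^{T}$ has a $1$-rainbow cycle; (ii) if $n\geq 7$, then $G_n^{T}$ has a $2$-rainbow cycle.
   Context: Consider a convex $n$-gon with vertices labeled clockwise $1,\dots,n$. A diagonal is a pair $\{i,j\}$ of vertices that are not adjacent on the polygon; let $E_n$ be the set of all diagonals. The directed graph $G_n^{T}$ has as vertices all triangulations of the $n$-gon. Whenever two triangulations $T,T'$ differ in exactly one diagonal, i.e. $T'$ is obtained from $T$ by removing the diagonal $e$ of a convex quadrilateral formed by two triangles and inserting the other diagonal $f$ of that quadrilateral (a flip), there is an arc $(T,T')$ labeled $f$ and an arc $(T',T)$ labeled $e$ (so each arc is labeled by the diagonal that enters the triangulation). For an integer $r\geq1$, an $r$-rainbow cycle in $G_n^{T}$ is a directed cycle (no repeated vertices) along which every diagonal in $E_n$ appears exactly $r$ times as an arc label. -}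

module Defs where

open import Data.Nat as ℕ using (ℕ; zero; suc)
open import Data.Fin as Fin using (Fin; toℕ)
open import Data.Bool using (Bool; true; false; if_then_else_; _∧_)
open import Data.Product using (Σ; ∃; _×_; _,_)
open import Data.Sum using (_⊎_)
open import Relation.Nullary using (¬_; does)
open import Relation.Binary.PropositionalEquality using (_≡_; _≢_)

-- Vertices of the convex n-gon: Fin n (vertex k+1 of the paper is 'k'),
-- in clockwise order 0,1,…,n-1.  A diagonal {i,j} is recorded as the
-- ordered pair (i , j) with i < j.
Diag : (n : ℕ) → Fin n → Fin n → Set
Diag n i j = (toℕ i ℕ.< toℕ j)
           × (toℕ j ≢ suc (toℕ i))
           × ¬ (toℕ i ≡ 0 × suc (toℕ j) ≡ n)

Cross : {n : ℕ} → Fin n → Fin n → Fin n → Fin n → Set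
Cross a b c d = (a Fin.< c × c Fin.< b × b Fin.< d)
              ⊎ (c Fin.< a × a Fin.< d × d Fin.< b)

DSet : ℕ → Set
DSet n = Fin n → Fin n → Bool

_∈D_ : {n : ℕ} → Fin n × Fin n → DSet n → Set
(i , j) ∈D S = S i j ≡ true

IsTriangulation : (n : ℕ) → DSet n → Set
IsTriangulation n T =
    (∀ i j → (i , j) ∈D T → Diag n i j)
  × (∀ a b c d → (a , b) ∈D T → (c , d) ∈D T → ¬ Cross a b c d)
  × (∀ i j → Diag n i j → ¬ ((i , j) ∈D T) →
       Σ (Fin n) λ c → Σ (Fin n) λ d → (c , d) ∈D T × Cross i j c d)

_≟P_ : {n : ℕ} → Fin n × Fin n → Fin n × Fin n → Bool
(i , j) ≟P (a , b) = does (i Fin.≟ a) ∧ does (j Fin.≟ b)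

replace : {n : ℕ} → DSet n → Fin n × Fin n → Fin n × Fin n → DSet n
replace T e f i j =
  if (i , j) ≟P f then true else (if (i , j) ≟P e then false else T i j)

_≐_ : {n : ℕ} → DSet n → DSet n → Set
S ≐ S' = ∀ i j → S i j ≡ S' i j

Arc : (n : ℕ) → DSet n → DSet n → Fin n × Fin n → Set
Arc n T T' f =
    IsTriangulation n T × IsTriangulation n T'
  × Σ (Fin n × Fin n) λ e → e ∈D T × ¬ (f ∈D T) × (T' ≐ replace T e f)

countLab : {n : ℕ} → (ℕ → Fin n × Fin n) → Fin n × Fin n → ℕ → ℕ
countLab lab d zero = zero
countLab lab d (suc k) =
  (if lab k ≟P d then suc zero else zero) ℕ.+ countLab lab d k

RainbowCycle : (n r : ℕ) → Set
RainbowCycle n r =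
  Σ ℕ λ k → Σ (ℕ → DSet n) λ T → Σ (ℕ → Fin n × Fin n) λ lab →
      (T k ≐ T 0)
    × (∀ m → m ℕ.< k → Arc n (T m) (T (suc m)) (lab m))
    × (∀ i j → i ℕ.< j → j ℕ.< k → ¬ (T i ≐ T j))
    × (∀ a b → Diag n a b → countLab lab (a , b) k ≡ r)

-- Triangulations are assembled from fans.  For a vertex g, Fan g t consists of the
-- diagonals {1,y} for 3 ≤ y ≤ t + 2, {0,y} for t + 2 ≤ y ≤ g and {g,y} for y ≥ g + 2.
-- Flipping {0,t+2} to {1,t+3} turns Fan g t into Fan g (t + 1), so a run of g - 2 flips
-- leads from Fan g 0 to Fan g (g - 2), and the latter is Fan g' 0 rotated by g when
-- g + g' = n + 1.  Runs can therefore be chained around the polygon into a closed walk in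
-- the flip graph, flip t of a run rotated by r inserting the diagonal {r + 1, r + t + 3}.
-- With g = n - 1 and the n rotations 0, ..., n - 1, every diagonal {a,b} is inserted
-- exactly twice, by the runs rotated by a - 1 and by b - 1.  Alternating g = 2 + α and
-- g = 2 + β, where n = 3 + α + β and β ∈ {α, α + 1}, the rotation advances by one every
-- two runs and every diagonal is inserted exactly once.  The triangulations of the walk
-- are pairwise distinct: the ears {w, w + 2} of a stage locate its rotation, and then the
-- fan determines how far the run has progressed.  For n = 4 the two-flip cycle is checked
-- by computation.
module Submission where

open import Data.Bool using (Bool; true; false; if_then_else_; _∧_; _∨_)
open import Data.Bool.Properties using (∧-comm; ∨-comm; ∧-zeroʳ; ∨-identityʳ; ∨-zeroʳ)
open import Data.Empty using (⊥; ⊥-elim)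
open import Data.Fin as Fin using (Fin; toℕ)
import Data.Fin.Properties as FP
open import Data.Nat as ℕ using (ℕ; zero; suc; _+_; _*_; _∸_; _≤_; _<_; _≥_; z≤n; s≤s; _≟_; _<?_; _≤?_; _%_)
open import Data.Nat.DivMod
open import Data.Nat.Properties
open import Data.Nat.Tactic.RingSolver
open import Data.Product
open import Data.Sum
open import Relation.Binary using (tri<; tri≈; tri>)
open import Relation.Binary.PropositionalEquality
open import Relation.Nullary
open import Relation.Nullary.Decidable using (_×-dec_; _⊎-dec_; dec-true; dec-false)

open import Defs

≡ᵇ-true : ∀ {x y} → x ≡ y → (x ℕ.≡ᵇ y) ≡ true
≡ᵇ-true {x} {y} = dec-true (x ≟ y)

≡ᵇ-false : ∀ {x y} → x ≢ y → (x ℕ.≡ᵇ y) ≡ false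
≡ᵇ-false {x} {y} = dec-false (x ≟ y)

<ᵇ-true : ∀ {x y} → x < y → (x ℕ.<ᵇ y) ≡ true
<ᵇ-true {x} {y} = dec-true (x <? y)

<ᵇ-false : ∀ {x y} → ¬ (x < y) → (x ℕ.<ᵇ y) ≡ false
<ᵇ-false {x} {y} = dec-false (x <? y)

does-true⇒ : ∀ {a} {A : Set a} (a? : Dec A) → does a? ≡ true → A
does-true⇒ (yes a) _ = a

<ᵇ-true⇒< : ∀ {x y} → (x ℕ.<ᵇ y) ≡ true → x < y
<ᵇ-true⇒< {x} {y} = does-true⇒ (x <? y)

∧-true : ∀ {a b} → (a ∧ b) ≡ true → a ≡ true × b ≡ true
∧-true {true} {true} _ = refl , refl

false≢true : false ≢ true
false≢true ()

does-⇔ : ∀ {a b} {A : Set a} {B : Set b} (a? : Dec A) (b? : Dec B) → (A → B) → (B → A) → does a? ≡ does b?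
does-⇔ (yes a) b? f g = sym (dec-true b? (f a))
does-⇔ (no ¬a) b? f g = sym (dec-false b? (λ b → ¬a (g b)))

count : (ℕ → Bool) → ℕ → ℕ
count B zero = zero
count B (suc k) = (if B k then suc zero else zero) + count B k

count-cong : ∀ B B' k → (∀ m → m < k → B m ≡ B' m) → count B k ≡ count B' k
count-cong B B' zero e = refl
count-cong B B' (suc k) e rewrite e k ≤-refl = cong (_ +_) (count-cong B B' k (λ m q → e m (<-trans q ≤-refl)))

count-≡ᵇ-zero : ∀ m₀ k → k ≤ m₀ → count (λ m → m ℕ.≡ᵇ m₀) k ≡ 0
count-≡ᵇ-zero m₀ zero _ = refl
count-≡ᵇ-zero m₀ (suc k) q rewrite ≡ᵇ-false {k} {m₀} (λ e → <-irrefl e q) = count-≡ᵇ-zero m₀ k (<⇒≤ q)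

count-≡ᵇ-one : ∀ m₀ k → m₀ < k → count (λ m → m ℕ.≡ᵇ m₀) k ≡ 1
count-≡ᵇ-one m₀ (suc k) q with k ≟ m₀
... | yes refl rewrite ≡ᵇ-true {k} refl = cong suc (count-≡ᵇ-zero k k ≤-refl)
... | no ne rewrite ≡ᵇ-false ne = count-≡ᵇ-one m₀ k (≤∧≢⇒< (≤-pred q) (≢-sym ne))

count-∨ : ∀ m₁ m₂ k → m₁ ≢ m₂ →
          count (λ m → (m ℕ.≡ᵇ m₁) ∨ (m ℕ.≡ᵇ m₂)) k ≡ count (λ m → m ℕ.≡ᵇ m₁) k + count (λ m → m ℕ.≡ᵇ m₂) k
count-∨ m₁ m₂ zero ne = refl
count-∨ m₁ m₂ (suc k) ne with k ≟ m₁ | k ≟ m₂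
... | yes refl | yes refl = ⊥-elim (ne refl)
... | yes refl | no n2 rewrite ≡ᵇ-true {k} refl | ≡ᵇ-false n2 = cong suc (count-∨ m₁ m₂ k ne)
... | no n1 | yes refl rewrite ≡ᵇ-true {k} refl | ≡ᵇ-false n1 = trans (cong suc (count-∨ m₁ m₂ k ne)) (sym (+-suc _ _))
... | no n1 | no n2 rewrite ≡ᵇ-false n1 | ≡ᵇ-false n2 = count-∨ m₁ m₂ k ne

≡ᵇ-pair-cases : ∀ x y a b → (x ≡ a × y ≡ b) ⊎ (((x ℕ.≡ᵇ a) ∧ (y ℕ.≡ᵇ b)) ≡ false × ¬ (x ≡ a × y ≡ b))
≡ᵇ-pair-cases x y a b with x ≟ a | y ≟ b
... | yes e1 | yes e2 = inj₁ (e1 , e2)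
... | yes e1 | no n2 rewrite ≡ᵇ-false n2 = inj₂ (∧-zeroʳ _ , λ (_ , e) → n2 e)
... | no n1 | _ rewrite ≡ᵇ-false n1 = inj₂ (refl , λ (e , _) → n1 e)

≡ᵇ-pair : ∀ {a b c d} → ((a ℕ.≡ᵇ c) ∧ (b ℕ.≡ᵇ d)) ≡ true → (a , b) ≡ (c , d)
≡ᵇ-pair {a} {b} {c} {d} e with ≡ᵇ-pair-cases a b c d
... | inj₁ (refl , refl) = refl
... | inj₂ (q , _) = ⊥-elim (false≢true (trans (sym q) e))

module Polygon (n₀ : ℕ) where
  n : ℕ
  n = suc n₀

  record _≡ₙ_ (x y : ℕ) : Set where
    constructor mk
    field get : x % n ≡ y % n
  open _≡ₙ_ public

  ≡⇒≡ₙ : ∀ {x y} → x ≡ y → x ≡ₙ y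
  ≡⇒≡ₙ refl = mk refl

  ≡ₙ-sym : ∀ {x y} → x ≡ₙ y → y ≡ₙ x
  ≡ₙ-sym (mk e) = mk (sym e)

  ≡ₙ-trans : ∀ {x y z} → x ≡ₙ y → y ≡ₙ z → x ≡ₙ z
  ≡ₙ-trans (mk e) (mk f) = mk (trans e f)

  ≡ₙ⇒≡ : ∀ {x y} → x < n → y < n → x ≡ₙ y → x ≡ y
  ≡ₙ⇒≡ x<n y<n (mk e) = trans (sym (m<n⇒m%n≡m x<n)) (trans e (m<n⇒m%n≡m y<n))

  n+≡ₙ : ∀ x → (x + n) ≡ₙ x
  n+≡ₙ x = mk ([m+n]%n≡m%n x n)

  ≡ₙ-+ʳ : ∀ {x y} z → x ≡ₙ y → (x + z) ≡ₙ (y + z)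
  ≡ₙ-+ʳ {x} {y} z (mk e) =
    mk (trans (%-distribˡ-+ x z n) (trans (cong (λ u → (u + z % n) % n) e) (sym (%-distribˡ-+ y z n))))

  -- Adding n₀ * z, i.e. (n - 1) z, undoes the addition of z.
  ≡ₙ-cancelʳ : ∀ {x y} z → (x + z) ≡ₙ (y + z) → x ≡ₙ y
  ≡ₙ-cancelʳ {x} {y} z e = mk (trans (sym (undo x)) (trans (get (≡ₙ-+ʳ (n₀ * z) e)) (undo y)))
    where
    undo : ∀ u → (u + z + n₀ * z) % n ≡ u % n
    undo u = trans (cong (_% n) (trans (+-assoc u z (n₀ * z)) (cong (u +_) (*-comm n z)))) ([m+kn]%n≡m%n u z n)

  ≡ₙ-+ˡ : ∀ {x y} z → x ≡ₙ y → (z + x) ≡ₙ (z + y)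
  ≡ₙ-+ˡ {x} {y} z e = ≡ₙ-trans (≡⇒≡ₙ (+-comm z x)) (≡ₙ-trans (≡ₙ-+ʳ z e) (≡⇒≡ₙ (+-comm y z)))

  ≡ₙ-suc : ∀ {x y} → x ≡ₙ y → suc x ≡ₙ suc y
  ≡ₙ-suc = ≡ₙ-+ˡ 1

  ≡ₙ-cancelˡ : ∀ {z x y} → (z + x) ≡ₙ (z + y) → x ≡ₙ y
  ≡ₙ-cancelˡ {z} {x} {y} e = ≡ₙ-cancelʳ z (≡ₙ-trans (≡⇒≡ₙ (+-comm x z)) (≡ₙ-trans e (≡⇒≡ₙ (+-comm z y))))

  ≡ₙ-cancelʳ⇒≡ : ∀ {a b} z → a < n → b < n → (a + z) ≡ₙ (b + z) → a ≡ b
  ≡ₙ-cancelʳ⇒≡ z an bn e = ≡ₙ⇒≡ an bn (≡ₙ-cancelʳ z e)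

  ≡+n⇒≡ₙ : ∀ {u w} → u ≡ w + n → u ≡ₙ w
  ≡+n⇒≡ₙ eq = ≡ₙ-trans (≡⇒≡ₙ eq) (n+≡ₙ _)

  ≡ₙ∧≢⇒⊥ : ∀ {u v} → u ≡ₙ v → u < n → v < n → u ≢ v → ⊥
  ≡ₙ∧≢⇒⊥ e un vn ne = ne (≡ₙ⇒≡ un vn e)

  next : ℕ → ℕ
  next x = suc x % n

  prev : ℕ → ℕ
  prev zero = n₀
  prev (suc x) = x

  next<n : ∀ x → next x < n
  next<n x = m%n<n (suc x) n

  prev<n : ∀ {x} → x < n → prev x < n
  prev<n {zero} _ = ≤-refl
  prev<n {suc x} (s≤s q) = s≤s (≤-trans (n≤1+n x) q)

  next≡ₙsuc : ∀ x → next x ≡ₙ suc x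
  next≡ₙsuc x = mk (m%n%n≡m%n (suc x) n)

  suc-prev≡ₙ : ∀ {x} → x < n → suc (prev x) ≡ₙ x
  suc-prev≡ₙ {zero} _ = mk (n%n≡0 n)
  suc-prev≡ₙ {suc x} _ = mk refl

  next-prev : ∀ {x} → x < n → next (prev x) ≡ x
  next-prev {x} q = ≡ₙ⇒≡ (next<n (prev x)) q (≡ₙ-trans (next≡ₙsuc (prev x)) (suc-prev≡ₙ q))

  prev-next : ∀ {x} → x < n → prev (next x) ≡ x
  prev-next {x} x<n with m≤n⇒m<n∨m≡n x<n
  ... | inj₁ sx<n = cong prev (m<n⇒m%n≡m sx<n)
  ... | inj₂ sx≡n = trans (cong prev (trans (cong (_% n) sx≡n) (n%n≡0 n))) (sym (suc-injective sx≡n))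

  prev-injective : ∀ {a b} → a < n → b < n → prev a ≡ prev b → a ≡ b
  prev-injective an bn e = trans (sym (next-prev an)) (trans (cong next e) (next-prev bn))

  Crosses : ℕ → ℕ → ℕ → ℕ → Set
  Crosses a b c d = (a < c × c < b × b < d) ⊎ (c < a × a < d × d < b)

  CrossesPair : ℕ × ℕ → ℕ × ℕ → Set
  CrossesPair (a , b) (c , d) = Crosses a b c d

  Crosses-sym : ∀ {a b c d} → Crosses a b c d → Crosses c d a b
  Crosses-sym (inj₁ q) = inj₂ q
  Crosses-sym (inj₂ q) = inj₁ q

  IsDiag : ℕ → ℕ → Set
  IsDiag x y = x < y × y < n × y ≢ suc x × ¬ (x ≡ 0 × suc y ≡ n)

  -- The image of a sorted pair under next (resp. prev), sorted again.
  nextDiag : ℕ → ℕ → ℕ × ℕ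
  nextDiag a b with suc b ≟ n
  ... | yes _ = (0 , suc a)
  ... | no _ = (suc a , suc b)

  prevDiag : ℕ → ℕ → ℕ × ℕ
  prevDiag zero b = (prev b , n₀)
  prevDiag (suc a) b = (a , prev b)

  Crosses-nextDiag : ∀ {a b c d} → b < n → d < n → Crosses a b c d → CrossesPair (nextDiag a b) (nextDiag c d)
  Crosses-nextDiag {a} {b} {c} {d} bn dn cr with suc b ≟ n | suc d ≟ n
  ... | yes e | yes e' with suc-injective (trans e (sym e'))
  ...   | refl with cr
  ...     | inj₁ (_ , _ , q) = ⊥-elim (<-irrefl refl q)
  ...     | inj₂ (_ , _ , q) = ⊥-elim (<-irrefl refl q)
  Crosses-nextDiag {d = d} bn dn (inj₁ (_ , _ , q)) | yes e | no _ = ⊥-elim (<⇒≱ q (≤-pred (subst (suc d ≤_) (sym e) dn)))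
  Crosses-nextDiag bn dn (inj₂ (q1 , q2 , q3)) | yes e | no _ = inj₁ (s≤s z≤n , s≤s q1 , s≤s q2)
  Crosses-nextDiag bn dn (inj₁ (q1 , q2 , q3)) | no _ | yes e' = inj₂ (s≤s z≤n , s≤s q1 , s≤s q2)
  Crosses-nextDiag {b = b} bn dn (inj₂ (_ , _ , q)) | no _ | yes e' = ⊥-elim (<⇒≱ q (≤-pred (subst (suc b ≤_) (sym e') bn)))
  Crosses-nextDiag bn dn (inj₁ (q1 , q2 , q3)) | no _ | no _ = inj₁ (s≤s q1 , s≤s q2 , s≤s q3)
  Crosses-nextDiag bn dn (inj₂ (q1 , q2 , q3)) | no _ | no _ = inj₂ (s≤s q1 , s≤s q2 , s≤s q3)

  Crosses-prevDiag : ∀ {a b c d} → a < b → c < d → b < n → d < n → Crosses a b c d → CrossesPair (prevDiag a b) (prevDiag c d)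
  Crosses-prevDiag {zero} {suc b} {zero} {suc d} _ _ _ _ (inj₁ (() , _))
  Crosses-prevDiag {zero} {suc b} {zero} {suc d} _ _ _ _ (inj₂ (() , _))
  Crosses-prevDiag {zero} {suc b} {suc c} {suc d} _ _ _ (s≤s dn) (inj₁ (_ , s≤s q2 , s≤s q3)) = inj₂ (q2 , q3 , dn)
  Crosses-prevDiag {zero} {suc b} {suc c} {suc d} _ _ _ _ (inj₂ (() , _))
  Crosses-prevDiag {suc a} {suc b} {zero} {suc d} _ _ _ _ (inj₁ (() , _))
  Crosses-prevDiag {suc a} {suc b} {zero} {suc d} _ _ (s≤s bn) _ (inj₂ (_ , s≤s q2 , s≤s q3)) = inj₁ (q2 , q3 , bn)
  Crosses-prevDiag {suc a} {suc b} {suc c} {suc d} _ _ _ _ (inj₁ (s≤s q1 , s≤s q2 , s≤s q3)) = inj₁ (q1 , q2 , q3)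
  Crosses-prevDiag {suc a} {suc b} {suc c} {suc d} _ _ _ _ (inj₂ (s≤s q1 , s≤s q2 , s≤s q3)) = inj₂ (q1 , q2 , q3)

  nextDiag-prevDiag : ∀ {a b} → a < b → b < n → nextDiag (proj₁ (prevDiag a b)) (proj₂ (prevDiag a b)) ≡ (a , b)
  nextDiag-prevDiag {zero} {suc b} _ _ with suc n₀ ≟ n
  ... | yes _ = refl
  ... | no ne = ⊥-elim (ne refl)
  nextDiag-prevDiag {suc a} {suc b} _ bn with suc b ≟ n
  ... | yes e = ⊥-elim (<-irrefl e bn)
  ... | no _ = refl

  prevDiag-nextDiag : ∀ {a b} → a < b → b < n → prevDiag (proj₁ (nextDiag a b)) (proj₂ (nextDiag a b)) ≡ (a , b)
  prevDiag-nextDiag {a} {b} ab bn with suc b ≟ n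
  ... | yes e = cong (a ,_) (suc-injective (sym e))
  ... | no _ = refl

  nextDiag-sorted : ∀ {a b} → a < b → proj₁ (nextDiag a b) < proj₂ (nextDiag a b)
  nextDiag-sorted {a} {b} ab with suc b ≟ n
  ... | yes _ = s≤s z≤n
  ... | no _ = s≤s ab

  nextDiag<n : ∀ {a b} → a < b → b < n → proj₂ (nextDiag a b) < n
  nextDiag<n {a} {b} ab bn with suc b ≟ n
  ... | yes e = ≤-trans (s≤s ab) bn
  ... | no ne = ≤∧≢⇒< bn ne

  prevDiag-sorted : ∀ {a b} → a < b → b < n → proj₁ (prevDiag a b) < proj₂ (prevDiag a b)
  prevDiag-sorted {zero} {suc b} _ (s≤s bn) = bn
  prevDiag-sorted {suc a} {suc b} (s≤s ab) _ = ab

  prevDiag<n : ∀ {a b} → a < b → b < n → proj₂ (prevDiag a b) < n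
  prevDiag<n {zero} {suc b} _ _ = ≤-refl
  prevDiag<n {suc a} {suc b} _ bn = <-trans (n<1+n b) bn

  IsDiag-nextDiag : ∀ {a b} → IsDiag a b → IsDiag (proj₁ (nextDiag a b)) (proj₂ (nextDiag a b))
  IsDiag-nextDiag {a} {b} (ab , bn , nb , nt) with suc b ≟ n
  ... | yes e = s≤s z≤n , ≤-trans (s≤s ab) bn , (λ e1 → nt (suc-injective e1 , e)) , λ (_ , e2) → nb (suc-injective (trans e (sym e2)))
  ... | no ne = s≤s ab , ≤∧≢⇒< bn ne , (λ e1 → nb (suc-injective e1)) , λ ()

  IsDiag-prevDiag : ∀ {a b} → IsDiag a b → IsDiag (proj₁ (prevDiag a b)) (proj₂ (prevDiag a b))
  IsDiag-prevDiag {zero} {suc b} (ab , s≤s bn , nb , nt) = bn , ≤-refl , (λ e → nt (refl , cong suc (sym e))) , λ (e , _) → nb (cong suc e)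
  IsDiag-prevDiag {suc a} {suc b} (s≤s ab , bn , nb , nt) = ab , <-trans (n<1+n b) bn , (λ e → nb (cong suc e)) , λ (_ , e) → <-irrefl e bn

  -- Diagonal sets are handled as symmetric Boolean relations on ℕ, of which only
  -- the vertices below n matter; toDSet below converts them to the DSet of Defs.
  Edges : Set
  Edges = ℕ → ℕ → Bool

  Symmetric : Edges → Set
  Symmetric U = ∀ x y → x < n → y < n → U x y ≡ U y x

  _≈_ : Edges → Edges → Set
  U ≈ V = ∀ x y → x < n → y < n → U x y ≡ V x y

  ≡⇒≈ : ∀ {U V} → U ≡ V → U ≈ V
  ≡⇒≈ refl x y _ _ = refl

  ≈-sym : ∀ {U V} → U ≈ V → V ≈ U
  ≈-sym e x y xn yn = sym (e x y xn yn)

  ≈-trans : ∀ {U V W} → U ≈ V → V ≈ W → U ≈ W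
  ≈-trans e f x y xn yn = trans (e x y xn yn) (f x y xn yn)

  ≈-fromSorted : ∀ {U V} → Symmetric U → Symmetric V →
                 (∀ x → x < n → U x x ≡ V x x) → (∀ x y → x < y → y < n → U x y ≡ V x y) → U ≈ V
  ≈-fromSorted su sv dd lt x y xn yn with <-cmp x y
  ... | tri< q _ _ = lt x y q yn
  ... | tri≈ _ refl _ = dd x xn
  ... | tri> _ _ q = trans (su x y xn yn) (trans (lt y x q xn) (sv y x yn xn))

  record Triangulation (U : Edges) : Set where
    field
      tri-sym : Symmetric U
      tri-diag : ∀ x y → x < y → y < n → U x y ≡ true → IsDiag x y
      tri-noncrossing : ∀ a b c d → a < b → b < n → c < d → d < n → U a b ≡ true → U c d ≡ true → ¬ Crosses a b c d
      tri-maximal : ∀ x y → IsDiag x y → U x y ≡ false → Σ ℕ λ c → Σ ℕ λ d → c < d × d < n × U c d ≡ true × Crosses x y c d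
  open Triangulation public

  Triangulation-≈ : ∀ {U V} → U ≈ V → Triangulation U → Triangulation V
  Triangulation-≈ {U} {V} e t = record
    { tri-sym = λ x y xn yn → trans (sym (e x y xn yn)) (trans (tri-sym t x y xn yn) (e y x yn xn))
    ; tri-diag = λ x y xy yn v → tri-diag t x y xy yn (trans (e x y (<-trans xy yn) yn) v)
    ; tri-noncrossing = λ a b c d ab bn cd dn v1 v2 →
        tri-noncrossing t a b c d ab bn cd dn (trans (e a b (<-trans ab bn) bn) v1) (trans (e c d (<-trans cd dn) dn) v2)
    ; tri-maximal = λ x y dg v →
        let (c , d , cd , dn , uc , cr) = tri-maximal t x y dg (trans (e x y (<-trans (proj₁ dg) (proj₁ (proj₂ dg))) (proj₁ (proj₂ dg))) v)
        in c , d , cd , dn , trans (sym (e c d (<-trans cd dn) dn)) uc , cr }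

  rotate : Edges → Edges
  rotate U x y = U (prev x) (prev y)

  atPair : Edges → ℕ × ℕ → Bool
  atPair U (a , b) = U a b

  rotate-prevDiag : ∀ U → Symmetric U → ∀ {x y} → x < y → y < n → rotate U x y ≡ atPair U (prevDiag x y)
  rotate-prevDiag U sy {zero} {suc y} _ (s≤s yn) = sy n₀ y ≤-refl (≤-trans yn (n≤1+n _))
  rotate-prevDiag U sy {suc x} {suc y} _ _ = refl

  Triangulation-rotate : ∀ {U} → Triangulation U → Triangulation (rotate U)
  Triangulation-rotate {U} t = record
    { tri-sym = λ x y xn yn → tri-sym t (prev x) (prev y) (prev<n xn) (prev<n yn)
    ; tri-diag = diag ; tri-noncrossing = noncrossing ; tri-maximal = maximal }
    where
    atPrev : ∀ {x y} → x < y → y < n → rotate U x y ≡ atPair U (prevDiag x y)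
    atPrev = rotate-prevDiag U (tri-sym t)
    diag : ∀ x y → x < y → y < n → rotate U x y ≡ true → IsDiag x y
    diag x y xy yn e = subst (λ q → IsDiag (proj₁ q) (proj₂ q)) (nextDiag-prevDiag xy yn)
      (IsDiag-nextDiag (tri-diag t _ _ (prevDiag-sorted xy yn) (prevDiag<n xy yn) (trans (sym (atPrev xy yn)) e)))
    noncrossing : ∀ a b c d → a < b → b < n → c < d → d < n → rotate U a b ≡ true → rotate U c d ≡ true → ¬ Crosses a b c d
    noncrossing a b c d ab bn cd dn e1 e2 cr =
      tri-noncrossing t _ _ _ _ (prevDiag-sorted ab bn) (prevDiag<n ab bn) (prevDiag-sorted cd dn) (prevDiag<n cd dn)
        (trans (sym (atPrev ab bn)) e1) (trans (sym (atPrev cd dn)) e2) (Crosses-prevDiag ab cd bn dn cr)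
    maximal : ∀ x y → IsDiag x y → rotate U x y ≡ false → Σ ℕ λ c → Σ ℕ λ d → c < d × d < n × rotate U c d ≡ true × Crosses x y c d
    maximal x y dg@(xy , yn , _) e with tri-maximal t _ _ (IsDiag-prevDiag dg) (trans (sym (atPrev xy yn)) e)
    ... | c , d , cd , dn , uc , cr =
      proj₁ (nextDiag c d) , proj₂ (nextDiag c d) , nextDiag-sorted cd , nextDiag<n cd dn ,
      trans (atPrev (nextDiag-sorted cd) (nextDiag<n cd dn)) (trans (cong (atPair U) (prevDiag-nextDiag cd dn)) uc) ,
      subst (λ q → CrossesPair q (nextDiag c d)) (nextDiag-prevDiag xy yn) (Crosses-nextDiag (prevDiag<n xy yn) dn cr)

  rotate-≈ : ∀ {U V} → U ≈ V → rotate U ≈ rotate V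
  rotate-≈ e x y xn yn = e (prev x) (prev y) (prev<n xn) (prev<n yn)

  samePair : ℕ → ℕ → ℕ → ℕ → Bool
  samePair x y a b = ((x ℕ.≡ᵇ a) ∧ (y ℕ.≡ᵇ b)) ∨ ((x ℕ.≡ᵇ b) ∧ (y ℕ.≡ᵇ a))

  exchange : Edges → ℕ × ℕ → ℕ × ℕ → Edges
  exchange U (a , b) (c , d) x y = if samePair x y c d then true else (if samePair x y a b then false else U x y)

  ≡ᵇ-next : ∀ {x a} → x < n → a < n → (x ℕ.≡ᵇ next a) ≡ (prev x ℕ.≡ᵇ a)
  ≡ᵇ-next {x} {a} xn an with x ≟ next a | prev x ≟ a
  ... | yes e | yes e' rewrite ≡ᵇ-true e | ≡ᵇ-true e' = refl
  ... | yes e | no ne = ⊥-elim (ne (trans (cong prev e) (prev-next an)))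
  ... | no ne | yes e = ⊥-elim (ne (trans (sym (next-prev xn)) (cong next e)))
  ... | no ne | no ne' rewrite ≡ᵇ-false ne | ≡ᵇ-false ne' = refl

  samePair-next : ∀ {x y a b} → x < n → y < n → a < n → b < n → samePair x y (next a) (next b) ≡ samePair (prev x) (prev y) a b
  samePair-next xn yn an bn rewrite ≡ᵇ-next xn an | ≡ᵇ-next yn bn | ≡ᵇ-next xn bn | ≡ᵇ-next yn an = refl

  rotate-exchange : ∀ U {a b c d} → a < n → b < n → c < n → d < n →
                    rotate (exchange U (a , b) (c , d)) ≈ exchange (rotate U) (next a , next b) (next c , next d)
  rotate-exchange U an bn cn dn x y xn yn rewrite samePair-next xn yn cn dn | samePair-next xn yn an bn = refl

  rotate^ : ℕ → Edges → Edges
  rotate^ zero U = U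
  rotate^ (suc k) U = rotate (rotate^ k U)

  next^ : ℕ → ℕ → ℕ
  next^ zero x = x
  next^ (suc k) x = next (next^ k x)

  next^<n : ∀ k {x} → x < n → next^ k x < n
  next^<n zero q = q
  next^<n (suc k) q = next<n _

  Triangulation-rotate^ : ∀ k {U} → Triangulation U → Triangulation (rotate^ k U)
  Triangulation-rotate^ zero t = t
  Triangulation-rotate^ (suc k) t = Triangulation-rotate (Triangulation-rotate^ k t)

  rotate^-≈ : ∀ k {U V} → U ≈ V → rotate^ k U ≈ rotate^ k V
  rotate^-≈ zero e = e
  rotate^-≈ (suc k) e = rotate-≈ (rotate^-≈ k e)

  rotate^-exchange : ∀ k U {a b c d} → a < n → b < n → c < n → d < n →
                     rotate^ k (exchange U (a , b) (c , d)) ≈ exchange (rotate^ k U) (next^ k a , next^ k b) (next^ k c , next^ k d)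
  rotate^-exchange zero U an bn cn dn x y xn yn = refl
  rotate^-exchange (suc k) U an bn cn dn = ≈-trans (rotate-≈ (rotate^-exchange k U an bn cn dn))
    (rotate-exchange (rotate^ k U) (next^<n k an) (next^<n k bn) (next^<n k cn) (next^<n k dn))

  toDSet : Edges → DSet n
  toDSet U i j = (toℕ i ℕ.<ᵇ toℕ j) ∧ U (toℕ i) (toℕ j)

  vertex : ℕ → Fin n
  vertex x = Fin.fromℕ< (m%n<n x n)

  toℕ-vertex : ∀ {x} → x < n → toℕ (vertex x) ≡ x
  toℕ-vertex {x} q = trans (FP.toℕ-fromℕ< (m%n<n x n)) (m<n⇒m%n≡m q)

  toDSet-≈ : ∀ {U V} → U ≈ V → toDSet U ≐ toDSet V
  toDSet-≈ e i j = cong ((toℕ i ℕ.<ᵇ toℕ j) ∧_) (e (toℕ i) (toℕ j) (FP.toℕ<n i) (FP.toℕ<n j))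

  toDSet-vertex : ∀ U {a b} → a < b → b < n → toDSet U (vertex a) (vertex b) ≡ U a b
  toDSet-vertex U {a} {b} ab bn rewrite toℕ-vertex (<-trans ab bn) | toℕ-vertex bn | <ᵇ-true ab = refl

  toDSet-injective : ∀ {U V} → Symmetric U → Symmetric V → (∀ x → x < n → U x x ≡ V x x) → toDSet U ≐ toDSet V → U ≈ V
  toDSet-injective {U} {V} su sv dd e =
    ≈-fromSorted su sv dd λ x y xy yn → trans (sym (toDSet-vertex U xy yn)) (trans (e (vertex x) (vertex y)) (toDSet-vertex V xy yn))

  Triangulation⇒IsTriangulation : ∀ {U} → Triangulation U → IsTriangulation n (toDSet U)
  Triangulation⇒IsTriangulation {U} t = diagonals , noncrossing , maximal
    where
    diagonals : ∀ i j → (i , j) ∈D toDSet U → Diag n i j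
    diagonals i j e with ∧-true {toℕ i ℕ.<ᵇ toℕ j} e
    ... | e1 , e2 with tri-diag t _ _ (<ᵇ-true⇒< e1) (FP.toℕ<n j) e2
    ...   | q1 , _ , q3 , q4 = q1 , q3 , q4
    noncrossing : ∀ a b c d → (a , b) ∈D toDSet U → (c , d) ∈D toDSet U → ¬ Cross a b c d
    noncrossing a b c d e e' with ∧-true {toℕ a ℕ.<ᵇ toℕ b} e | ∧-true {toℕ c ℕ.<ᵇ toℕ d} e'
    ... | e1 , e2 | e3 , e4 = tri-noncrossing t _ _ _ _ (<ᵇ-true⇒< e1) (FP.toℕ<n b) (<ᵇ-true⇒< e3) (FP.toℕ<n d) e2 e4
    maximal : ∀ i j → Diag n i j → ¬ ((i , j) ∈D toDSet U) →
              Σ (Fin n) λ c → Σ (Fin n) λ d → (c , d) ∈D toDSet U × Cross i j c d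
    maximal i j (q1 , q3 , q4) ne with U (toℕ i) (toℕ j) in eq
    ... | true = ⊥-elim (ne (cong (_∧ true) (<ᵇ-true q1)))
    ... | false with tri-maximal t _ _ (q1 , FP.toℕ<n j , q3 , q4) eq
    ...   | c , d , cd , dn , uc , cr = vertex c , vertex d , trans (toDSet-vertex U cd dn) uc ,
            subst₂ (Crosses (toℕ i) (toℕ j)) (sym (toℕ-vertex (<-trans cd dn))) (sym (toℕ-vertex dn)) cr

  samePair-sorted : ∀ {x y a b} → x < y → a < b → samePair x y a b ≡ ((x ℕ.≡ᵇ a) ∧ (y ℕ.≡ᵇ b))
  samePair-sorted {x} {y} {a} {b} xy ab with x ≟ b | y ≟ a
  ... | yes refl | yes refl = ⊥-elim (<-asym xy ab)
  ... | yes e | no ne rewrite ≡ᵇ-false ne = trans (cong (((x ℕ.≡ᵇ a) ∧ (y ℕ.≡ᵇ b)) ∨_) (∧-zeroʳ _)) (∨-identityʳ _)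
  ... | no ne | _ rewrite ≡ᵇ-false ne = ∨-identityʳ _

  samePair-unsorted : ∀ {x y a b} → ¬ (x < y) → a < b → ((x ℕ.≡ᵇ a) ∧ (y ℕ.≡ᵇ b)) ≡ false
  samePair-unsorted {x} {y} {a} {b} nxy ab with x ≟ a | y ≟ b
  ... | yes refl | yes refl = ⊥-elim (nxy ab)
  ... | yes e | no ne rewrite ≡ᵇ-false ne = ∧-zeroʳ _
  ... | no ne | _ rewrite ≡ᵇ-false ne = refl

  ≟-vertex : ∀ (i : Fin n) {a} → a < n → does (i Fin.≟ vertex a) ≡ (toℕ i ℕ.≡ᵇ a)
  ≟-vertex i {a} an with i Fin.≟ vertex a
  ... | yes e = sym (≡ᵇ-true (trans (cong toℕ e) (toℕ-vertex an)))
  ... | no ne = sym (≡ᵇ-false (λ e → ne (FP.toℕ-injective (trans e (sym (toℕ-vertex an))))))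

  toDSet-exchange : ∀ U {a b c d} → a < b → b < n → c < d → d < n →
                    toDSet (exchange U (a , b) (c , d)) ≐ replace (toDSet U) (vertex a , vertex b) (vertex c , vertex d)
  toDSet-exchange U {a} {b} {c} {d} ab bn cd dn i j
    rewrite ≟-vertex i (<-trans cd dn) | ≟-vertex j dn | ≟-vertex i (<-trans ab bn) | ≟-vertex j bn
    with toℕ i <? toℕ j
  ... | yes q rewrite <ᵇ-true q | samePair-sorted q cd | samePair-sorted q ab = refl
  ... | no q rewrite <ᵇ-false q | samePair-unsorted q cd | samePair-unsorted q ab = refl

  exchange-arc : ∀ {U V a b c d} → Triangulation U → Triangulation V → a < b → b < n → c < d → d < n →
                 U a b ≡ true → U c d ≡ false → V ≈ exchange U (a , b) (c , d) →
                 Arc n (toDSet U) (toDSet V) (vertex c , vertex d)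
  exchange-arc {U} {V} {a} {b} {c} {d} tu tv ab bn cd dn e1 e2 r =
    Triangulation⇒IsTriangulation tu , Triangulation⇒IsTriangulation tv , (vertex a , vertex b) , trans (toDSet-vertex U ab bn) e1 ,
    (λ e → false≢true (trans (sym (trans (toDSet-vertex U cd dn) e2)) e)) ,
    λ i j → trans (toDSet-≈ r i j) (toDSet-exchange U ab bn cd dn i j)

  samePair-swapʳ : ∀ x y a b → samePair x y a b ≡ samePair x y b a
  samePair-swapʳ x y a b = ∨-comm ((x ℕ.≡ᵇ a) ∧ (y ℕ.≡ᵇ b)) _

  samePair-swapˡ : ∀ x y a b → samePair x y a b ≡ samePair y x a b
  samePair-swapˡ x y a b rewrite ∧-comm (x ℕ.≡ᵇ a) (y ℕ.≡ᵇ b) | ∧-comm (x ℕ.≡ᵇ b) (y ℕ.≡ᵇ a) = ∨-comm ((y ℕ.≡ᵇ b) ∧ (x ℕ.≡ᵇ a)) _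

  exchange-swapˡ : ∀ U a b f x y → exchange U (a , b) f x y ≡ exchange U (b , a) f x y
  exchange-swapˡ U a b (c , d) x y rewrite samePair-swapʳ x y a b = refl

  exchange-swapʳ : ∀ U e c d x y → exchange U e (c , d) x y ≡ exchange U e (d , c) x y
  exchange-swapʳ U (a , b) c d x y rewrite samePair-swapʳ x y c d = refl

module Fans (n₀ : ℕ) where
  open Polygon n₀

  InFan : ℕ → ℕ → ℕ → ℕ → Set
  InFan g t x y = (x ≡ 1 × 3 ≤ y × y ≤ 2 + t) ⊎ (x ≡ 0 × 2 + t ≤ y × y ≤ g × 2 + y ≤ n) ⊎ (x ≡ g × 2 + g ≤ y × y < n)

  inFan? : ∀ g t x y → Dec (InFan g t x y)
  inFan? g t x y = ((x ≟ 1) ×-dec ((3 ≤? y) ×-dec (y ≤? 2 + t))) ⊎-dec (((x ≟ 0) ×-dec ((2 + t ≤? y) ×-dec ((y ≤? g) ×-dec (2 + y ≤? n)))) ⊎-dec ((x ≟ g) ×-dec ((2 + g ≤? y) ×-dec (y <? n))))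

  Fan : ℕ → ℕ → Edges
  Fan g t x y = does (inFan? g t x y) ∨ does (inFan? g t y x)

  InFan⇒< : ∀ {g t x y} → InFan g t x y → x < y
  InFan⇒< (inj₁ (refl , q , _)) = ≤-trans (s≤s (s≤s z≤n)) q
  InFan⇒< (inj₂ (inj₁ (refl , q , _))) = ≤-trans (s≤s z≤n) q
  InFan⇒< (inj₂ (inj₂ (refl , q , _))) = ≤-trans (n≤1+n _) q

  Fan-sorted : ∀ {g t x y} → x < y → Fan g t x y ≡ does (inFan? g t x y)
  Fan-sorted {g} {t} {x} {y} xy rewrite dec-false (inFan? g t y x) (λ q → <-asym xy (InFan⇒< q)) = ∨-identityʳ _

  Fan-true⇒ : ∀ {g t x y} → x < y → Fan g t x y ≡ true → InFan g t x y
  Fan-true⇒ xy e = does-true⇒ (inFan? _ _ _ _) (trans (sym (Fan-sorted xy)) e)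

  Fan-sym : ∀ g t x y → Fan g t x y ≡ Fan g t y x
  Fan-sym g t x y = ∨-comm (does (inFan? g t x y)) _

  Fan-irrefl : ∀ g t x → Fan g t x x ≡ false
  Fan-irrefl g t x rewrite dec-false (inFan? g t x x) (λ q → <-irrefl refl (InFan⇒< q)) = refl

  2≰1 : ∀ {t} → ¬ (2 + t ≤ 1)
  2≰1 (s≤s ())

  InFan⇒IsDiag : ∀ {g t x y} → 2 ≤ g → y < n → InFan g t x y → IsDiag x y
  InFan⇒IsDiag {g} {t} g2 yn (inj₁ (refl , q , r)) = InFan⇒< {g} {t} (inj₁ (refl , q , r)) , yn , (λ { refl → <-irrefl refl q }) , λ ()
  InFan⇒IsDiag {g} {t} {x} {y} g2 yn (inj₂ (inj₁ (refl , q , r , w))) = InFan⇒< {g} {t} (inj₂ (inj₁ (refl , q , r , w))) , yn ,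
     (λ { refl → 2≰1 q }) , λ (_ , e) → <-irrefl e w
  InFan⇒IsDiag {g} {t} {x} {y} g2 yn (inj₂ (inj₂ (refl , q , r))) = InFan⇒< {g} {t} (inj₂ (inj₂ (refl , q , r))) , yn ,
     (λ { refl → <-irrefl refl q }) ,
     λ (e , _) → <-irrefl (sym e) (≤-trans (s≤s z≤n) g2)

  Fan-intro : ∀ {g t x y} → x < y → InFan g t x y → Fan g t x y ≡ true
  Fan-intro xy q = trans (Fan-sorted xy) (dec-true (inFan? _ _ _ _) q)

  Fan-elim : ∀ {g t x y} → x < y → Fan g t x y ≡ false → ¬ InFan g t x y
  Fan-elim xy e q = false≢true (trans (sym e) (Fan-intro xy q))

  Triangulation-Fan₀ : ∀ {g} → 2 ≤ g → g < n → Triangulation (Fan g 0)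
  Triangulation-Fan₀ {g} g2 gn = record
    { tri-sym = λ x y _ _ → Fan-sym g 0 x y
    ; tri-diag = λ x y xy yn e → InFan⇒IsDiag g2 yn (Fan-true⇒ xy e)
    ; tri-noncrossing = noncrossing ; tri-maximal = maximal }
    where
    noncrossing : ∀ a b c d → a < b → b < n → c < d → d < n → Fan g 0 a b ≡ true → Fan g 0 c d ≡ true → ¬ Crosses a b c d
    noncrossing a b c d ab bn cd dn e1 e2 = go (Fan-true⇒ ab e1) (Fan-true⇒ cd e2)
      where
      go : InFan g 0 a b → InFan g 0 c d → ¬ Crosses a b c d
      go (inj₁ (_ , q , r)) _ = ⊥-elim (<-irrefl refl (≤-trans q r))
      go _ (inj₁ (_ , q , r)) = ⊥-elim (<-irrefl refl (≤-trans q r))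
      go (inj₂ (inj₁ (refl , _))) (inj₂ (inj₁ (refl , _))) (inj₁ (() , _))
      go (inj₂ (inj₁ (refl , _))) (inj₂ (inj₁ (refl , _))) (inj₂ (() , _))
      go (inj₂ (inj₁ (refl , _ , bg , _))) (inj₂ (inj₂ (refl , _))) (inj₁ (_ , gb , _)) = <⇒≱ gb bg
      go (inj₂ (inj₁ (refl , _))) (inj₂ (inj₂ (refl , _))) (inj₂ (() , _))
      go (inj₂ (inj₂ (refl , _))) (inj₂ (inj₁ (refl , _))) (inj₁ (() , _))
      go (inj₂ (inj₂ (refl , _))) (inj₂ (inj₁ (refl , _ , dg , _))) (inj₂ (_ , gd , _)) = <⇒≱ gd dg
      go (inj₂ (inj₂ (refl , _))) (inj₂ (inj₂ (refl , _))) (inj₁ (q , _)) = <-irrefl refl q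
      go (inj₂ (inj₂ (refl , _))) (inj₂ (inj₂ (refl , _))) (inj₂ (q , _)) = <-irrefl refl q
    maximal : ∀ x y → IsDiag x y → Fan g 0 x y ≡ false → Σ ℕ λ c → Σ ℕ λ d → c < d × d < n × Fan g 0 c d ≡ true × Crosses x y c d
    maximal zero y (xy , yn , nb , nt) e with y ≤? g
    ... | yes yg = ⊥-elim (Fan-elim xy e (inj₂ (inj₁ (refl , ≤∧≢⇒< xy (≢-sym nb) , yg , ≤∧≢⇒< yn λ e' → nt (refl , e')))))
    ... | no yg = g , n₀ , <-trans gy (≤-pred y2) , ≤-refl , Fan-intro (<-trans gy (≤-pred y2)) (inj₂ (inj₂ (refl , ≤-trans (s≤s gy) (≤-pred y2) , ≤-refl))) ,
                  inj₁ (≤-trans (s≤s z≤n) g2 , gy , ≤-pred y2)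
      where gy : g < y
            gy = ≰⇒> yg
            y2 : suc y < n
            y2 = ≤∧≢⇒< yn λ e' → nt (refl , e')
    maximal (suc x) y (xy , yn , nb , nt) e with <-cmp (suc x) g
    ... | tri< xg _ _ with y ≤? g
    ...   | yes yg = 0 , suc (suc x) , s≤s z≤n , <-trans x2y yn ,
             Fan-intro (s≤s z≤n) (inj₂ (inj₁ (refl , s≤s (s≤s z≤n) , xg , ≤-trans (s≤s x2y) yn))) , inj₂ (s≤s z≤n , ≤-refl , x2y)
      where x2y : suc (suc x) < y
            x2y = ≤∧≢⇒< xy (≢-sym nb)
    ...   | no yg = 0 , g , ≤-trans (s≤s z≤n) g2 , <-trans gy yn ,
             Fan-intro (≤-trans (s≤s z≤n) g2) (inj₂ (inj₁ (refl , g2 , ≤-refl , ≤-trans (s≤s gy) yn))) , inj₂ (s≤s z≤n , xg , gy)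
      where gy : g < y
            gy = ≰⇒> yg
    maximal (suc x) y (xy , yn , nb , nt) e | tri≈ _ refl _ = ⊥-elim (Fan-elim xy e (inj₂ (inj₂ (refl , ≤∧≢⇒< xy (≢-sym nb) , yn))))
    maximal (suc x) y (xy , yn , nb , nt) e | tri> _ _ gx = g , suc (suc x) , <-trans gx ≤-refl , <-trans x2y yn ,
             Fan-intro (<-trans gx ≤-refl) (inj₂ (inj₂ (refl , s≤s gx , <-trans x2y yn))) , inj₂ (gx , ≤-refl , x2y)
      where x2y : suc (suc x) < y
            x2y = ≤∧≢⇒< xy (≢-sym nb)

  module ZeroFlip (U : Edges) (c : ℕ) (c2 : 2 ≤ c) where
    V : Edges
    V = exchange U (0 , c) (1 , suc c)

    exchange-cases : ∀ {x y} → x < y → (x ≡ 1 × y ≡ suc c × V x y ≡ true) ⊎ (x ≡ 0 × y ≡ c × V x y ≡ false) ⊎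
             (V x y ≡ U x y × ¬ (x ≡ 1 × y ≡ suc c) × ¬ (x ≡ 0 × y ≡ c))
    exchange-cases {x} {y} xy rewrite samePair-sorted xy (s≤s (≤-trans (s≤s z≤n) c2)) | samePair-sorted xy (≤-trans (s≤s z≤n) c2)
      with ≡ᵇ-pair-cases x y 1 (suc c)
    ... | inj₁ (e1 , e2) rewrite ≡ᵇ-true e1 | ≡ᵇ-true e2 = inj₁ (e1 , e2 , refl)
    ... | inj₂ (q , ne) rewrite q with ≡ᵇ-pair-cases x y 0 c
    ...   | inj₁ (e1 , e2) rewrite ≡ᵇ-true e1 | ≡ᵇ-true e2 = inj₂ (inj₁ (e1 , e2 , refl))
    ...   | inj₂ (q' , ne') rewrite q' = inj₂ (inj₂ (refl , ne , ne'))

    -- The flip is legal when 0, 1, c, c+1 bound a quadrilateral of U: besides {0,c},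
    -- its sides {1,c} and {0,c+1} are edges of the polygon or diagonals of U.
    module Legal (t : Triangulation U) (cn : suc c < n) (e0 : U 0 c ≡ true)
              (side1 : c ≡ 2 ⊎ U 1 c ≡ true) (side2 : suc c ≡ n₀ ⊎ U 0 (suc c) ≡ true) where
      0<c : 0 < c
      0<c = ≤-trans (s≤s z≤n) c2
      1<c : 1 < c
      1<c = c2
      1<sc : 1 < suc c
      1<sc = s≤s 0<c
      c<n : c < n
      c<n = <-trans (n<1+n c) cn

      U01 : ∀ {v} → suc c < v → v < n → U 0 (suc c) ≡ true
      U01 {v} q vn = [ (λ e → ⊥-elim (<⇒≱ q (≤-pred (subst (λ z → v < suc z) (sym e) vn)))) , (λ u → u) ]′ side2
      U1c : ∀ {u} → 1 < u → u < c → U 1 c ≡ true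
      U1c q r = [ (λ { refl → ⊥-elim (<⇒≱ q (≤-pred r)) }) , (λ u → u) ]′ side1

      crossF : ∀ {u v} → u < v → v < n → U u v ≡ true → ¬ (u ≡ 0 × v ≡ c) → ¬ Crosses 1 (suc c) u v
      crossF {u} {v} uv vn uu ne (inj₁ (1u , usc , scv)) with u ≟ c
      ... | yes refl = tri-noncrossing t 0 (suc c) c v (s≤s z≤n) cn uv vn (U01 scv vn) uu (inj₁ (0<c , ≤-refl , scv))
      ... | no ne' = tri-noncrossing t 0 c u v 0<c c<n uv vn e0 uu (inj₁ (≤-trans (s≤s z≤n) 1u , ≤∧≢⇒< (≤-pred usc) ne' , <-trans (n<1+n c) scv))
      crossF {u} {v} uv vn uu ne (inj₂ (u1 , 1v , vsc)) with n<1⇒n≡0 u1 | v ≟ c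
      ... | refl | yes refl = ne (refl , refl)
      ... | refl | no ne' = tri-noncrossing t 1 c u v 1<c c<n uv vn (U1c 1v vc) uu (inj₂ (u1 , 1v , vc))
        where vc : v < c
              vc = ≤∧≢⇒< (≤-pred vsc) ne'

      Vf : V 1 (suc c) ≡ true
      Vf with exchange-cases 1<sc
      ... | inj₁ (_ , _ , v) = v
      ... | inj₂ (inj₁ (() , _))
      ... | inj₂ (inj₂ (_ , nf , _)) = ⊥-elim (nf (refl , refl))

      Vother : ∀ {x y} → x < y → U x y ≡ true → ¬ (x ≡ 0 × y ≡ c) → V x y ≡ true
      Vother xy u ne with exchange-cases xy
      ... | inj₁ (_ , _ , v) = v
      ... | inj₂ (inj₁ (e1 , e2 , _)) = ⊥-elim (ne (e1 , e2))
      ... | inj₂ (inj₂ (vu , _ , _)) = trans vu u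

      triangulation : Triangulation V
      triangulation = record { tri-sym = sy ; tri-diag = diag ; tri-noncrossing = noncrossing ; tri-maximal = maximal }
        where
        sy : Symmetric V
        sy x y xn yn rewrite samePair-swapˡ x y 1 (suc c) | samePair-swapˡ x y 0 c | tri-sym t x y xn yn = refl
        diag : ∀ x y → x < y → y < n → V x y ≡ true → IsDiag x y
        diag x y xy yn ev with exchange-cases xy
        ... | inj₁ (refl , refl , _) = 1<sc , yn , (λ e → <-irrefl (sym (suc-injective e)) 1<c) , λ ()
        ... | inj₂ (inj₁ (_ , _ , vf)) = ⊥-elim (false≢true (trans (sym vf) ev))
        ... | inj₂ (inj₂ (vu , _ , _)) = tri-diag t x y xy yn (trans (sym vu) ev)
        noncrossing : ∀ a b c' d → a < b → b < n → c' < d → d < n → V a b ≡ true → V c' d ≡ true → ¬ Crosses a b c' d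
        noncrossing a b c' d ab bn cd dn e1 e2 cr with exchange-cases ab | exchange-cases cd
        ... | inj₂ (inj₁ (_ , _ , vf)) | _ = false≢true (trans (sym vf) e1)
        ... | _ | inj₂ (inj₁ (_ , _ , vf)) = false≢true (trans (sym vf) e2)
        ... | inj₁ (refl , refl , _) | inj₁ (refl , refl , _) = [ (λ q → <-irrefl refl (proj₁ q)) , (λ q → <-irrefl refl (proj₁ q)) ]′ cr
        ... | inj₁ (refl , refl , _) | inj₂ (inj₂ (vu , _ , ne)) = crossF cd dn (trans (sym vu) e2) ne cr
        ... | inj₂ (inj₂ (vu , _ , ne)) | inj₁ (refl , refl , _) = crossF ab bn (trans (sym vu) e1) ne (Crosses-sym cr)
        ... | inj₂ (inj₂ (vu , _ , _)) | inj₂ (inj₂ (vu' , _ , _)) = tri-noncrossing t a b c' d ab bn cd dn (trans (sym vu) e1) (trans (sym vu') e2) cr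
        maximal : ∀ x y → IsDiag x y → V x y ≡ false → Σ ℕ λ c' → Σ ℕ λ d → c' < d × d < n × V c' d ≡ true × Crosses x y c' d
        maximal x y dg ev with exchange-cases (proj₁ dg)
        ... | inj₁ (_ , _ , vt) = ⊥-elim (false≢true (trans (sym ev) vt))
        ... | inj₂ (inj₁ (refl , refl , _)) = 1 , suc c , 1<sc , cn , Vf , inj₁ (s≤s z≤n , 1<c , ≤-refl)
        ... | inj₂ (inj₂ (vu , nf , ne)) with tri-maximal t x y dg (trans (sym vu) ev)
        ...   | c' , d , cd , dn , uc , cr with exchange-cases cd
        ...     | inj₁ (_ , _ , vt) = c' , d , cd , dn , vt , cr
        ...     | inj₂ (inj₂ (vu' , _ , _)) = c' , d , cd , dn , trans vu' uc , cr
        ...     | inj₂ (inj₁ (refl , refl , _)) = go cr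
          where
          yn : y < n
          yn = proj₁ (proj₂ dg)
          go : Crosses x y 0 c → Σ ℕ λ c' → Σ ℕ λ d → c' < d × d < n × V c' d ≡ true × Crosses x y c' d
          go (inj₁ (() , _))
          go (inj₂ (0x , xc , cy)) with x ≟ 1 | y ≟ suc c
          ... | yes refl | yes refl = ⊥-elim (nf (refl , refl))
          ... | yes refl | no ne' = 0 , suc c , s≤s z≤n , cn , Vother (s≤s z≤n) (U01 scy yn) (λ (_ , e) → <-irrefl (sym e) ≤-refl) ,
                                     inj₂ (s≤s z≤n , 1<sc , scy)
            where scy : suc c < y
                  scy = ≤∧≢⇒< cy (≢-sym ne')
          ... | no ne1 | yes refl = 1 , c , 1<c , c<n , Vother 1<c (U1c 1x xc) (λ ()) , inj₂ (1x , xc , ≤-refl)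
            where 1x : 1 < x
                  1x = ≤∧≢⇒< 0x (≢-sym ne1)
          ... | no ne1 | no ne' = 1 , suc c , 1<sc , cn , Vf , inj₂ (1x , <-trans xc ≤-refl , ≤∧≢⇒< cy (≢-sym ne'))
            where 1x : 1 < x
                  1x = ≤∧≢⇒< 0x (≢-sym ne1)

  exchange-sym : ∀ U → Symmetric U → ∀ e f x y → x < n → y < n → exchange U e f x y ≡ exchange U e f y x
  exchange-sym U su (a , b) (c , d) x y xn yn rewrite samePair-swapˡ x y c d | samePair-swapˡ x y a b | su x y xn yn = refl

  samePair-irrefl : ∀ {a b} x → a ≢ b → samePair x x a b ≡ false
  samePair-irrefl {a} {b} x ne with x ≟ a | x ≟ b
  ... | yes refl | yes refl = ⊥-elim (ne refl)
  ... | yes refl | no nb rewrite ≡ᵇ-false nb | ≡ᵇ-true {x} refl = refl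
  ... | no na | yes refl rewrite ≡ᵇ-false na | ≡ᵇ-true {x} refl = refl
  ... | no na | no nb rewrite ≡ᵇ-false na | ≡ᵇ-false nb = refl

  1≢3 : ∀ {t} → 1 ≢ 3 + t
  1≢3 ()
  0≢2 : ∀ {t} → 0 ≢ 2 + t
  0≢2 ()

  Fan-step : ∀ {g t} → 3 ≤ g → 3 + t ≤ g → Fan g (suc t) ≈ exchange (Fan g t) (0 , 2 + t) (1 , 3 + t)
  Fan-step {g} {t} g3 tg = ≈-fromSorted (λ x y _ _ → Fan-sym g (suc t) x y) (exchange-sym (Fan g t) (λ x y _ _ → Fan-sym g t x y) _ _) diagonal sorted
    where
    diagonal : ∀ x → x < n → Fan g (suc t) x x ≡ exchange (Fan g t) (0 , 2 + t) (1 , 3 + t) x x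
    diagonal x _ rewrite samePair-irrefl x (λ (e : 1 ≡ 3 + t) → 1≢3 e) | samePair-irrefl x (λ (e : 0 ≡ 2 + t) → 0≢2 e) | Fan-irrefl g t x | Fan-irrefl g (suc t) x = refl
    sorted : ∀ x y → x < y → y < n → Fan g (suc t) x y ≡ exchange (Fan g t) (0 , 2 + t) (1 , 3 + t) x y
    sorted x y xy yn with ZeroFlip.exchange-cases (Fan g t) (2 + t) (s≤s (s≤s z≤n)) xy
    ... | inj₁ (refl , refl , v) = trans (Fan-intro {g} {suc t} xy (inj₁ (refl , s≤s (s≤s (s≤s z≤n)) , ≤-refl))) (sym v)
    ... | inj₂ (inj₁ (refl , refl , v)) = trans (trans (Fan-sorted {g} {suc t} xy) (dec-false (inFan? _ _ _ _) nq)) (sym v)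
      where
      nq : ¬ InFan g (suc t) 0 (2 + t)
      nq (inj₁ (() , _))
      nq (inj₂ (inj₁ (_ , q , _))) = <-irrefl refl q
      nq (inj₂ (inj₂ (e , _))) = <-irrefl e (≤-trans (s≤s z≤n) g3)
    ... | inj₂ (inj₂ (vu , nf , ne)) = trans (Fan-sorted {g} {suc t} xy) (trans (does-⇔ (inFan? _ _ _ _) (inFan? _ _ _ _) f1 f2) (trans (sym (Fan-sorted {g} {t} xy)) (sym vu)))
      where
      f1 : InFan g (suc t) x y → InFan g t x y
      f1 (inj₁ (refl , q , r)) = inj₁ (refl , q , ≤-pred (≤∧≢⇒< r (λ e → nf (refl , e))))
      f1 (inj₂ (inj₁ (refl , q , r))) = inj₂ (inj₁ (refl , ≤-trans (n≤1+n _) q , r))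
      f1 (inj₂ (inj₂ q)) = inj₂ (inj₂ q)
      f2 : InFan g t x y → InFan g (suc t) x y
      f2 (inj₁ (refl , q , r)) = inj₁ (refl , q , ≤-trans r (n≤1+n _))
      f2 (inj₂ (inj₁ (refl , q , r))) = inj₂ (inj₁ (refl , ≤∧≢⇒< q (λ e → ne (refl , sym e)) , r))
      f2 (inj₂ (inj₂ q)) = inj₂ (inj₂ q)

  Fan-outgoing : ∀ {g t} → g < n → 3 + t ≤ g → Fan g t 0 (2 + t) ≡ true
  Fan-outgoing {g} {t} gn tg = Fan-intro {g} {t} (s≤s z≤n) (inj₂ (inj₁ (refl , ≤-refl , ≤-trans (n≤1+n _) tg , ≤-trans (s≤s tg) gn)))

  Fan-incoming : ∀ {g t} → 3 ≤ g → Fan g t 1 (3 + t) ≡ false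
  Fan-incoming {g} {t} g3 = trans (Fan-sorted {g} {t} (s≤s (s≤s z≤n))) (dec-false (inFan? _ _ _ _) nq)
    where
    nq : ¬ InFan g t 1 (3 + t)
    nq (inj₁ (_ , _ , r)) = <-irrefl refl r
    nq (inj₂ (inj₁ (() , _)))
    nq (inj₂ (inj₂ (refl , _))) = <⇒≱ (s≤s (s≤s z≤n)) g3

  Triangulation-Fan : ∀ {g} t → 3 ≤ g → g < n → 2 + t ≤ g → Triangulation (Fan g t)
  Triangulation-Fan {g} zero g3 gn _ = Triangulation-Fan₀ (≤-trans (n≤1+n _) g3) gn
  Triangulation-Fan {g} (suc t) g3 gn tg = Triangulation-≈ (≈-sym (Fan-step g3 tg))
      (ZeroFlip.Legal.triangulation (Fan g t) (2 + t) (s≤s (s≤s z≤n)) (Triangulation-Fan t g3 gn (≤-trans (n≤1+n _) tg)) (≤-trans (s≤s tg) gn) (Fan-outgoing gn tg) side1 side2)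
    where
    side1 : 2 + t ≡ 2 ⊎ Fan g t 1 (2 + t) ≡ true
    side1 = s1 t
      where
      s1 : ∀ t → 2 + t ≡ 2 ⊎ Fan g t 1 (2 + t) ≡ true
      s1 zero = inj₁ refl
      s1 (suc t') = inj₂ (Fan-intro {g} {suc t'} (s≤s (s≤s z≤n)) (inj₁ (refl , s≤s (s≤s (s≤s z≤n)) , ≤-refl)))
    side2 : 3 + t ≡ n₀ ⊎ Fan g t 0 (3 + t) ≡ true
    side2 with 3 + t ≟ n₀
    ... | yes e = inj₁ e
    ... | no ne = inj₂ (Fan-intro {g} {t} (s≤s z≤n) (inj₂ (inj₁ (refl , n≤1+n _ , tg , s≤s (≤∧≢⇒< (≤-trans tg (≤-pred gn)) ne)))))

module Schedules (n₀ : ℕ) where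
  open Polygon n₀
  open Fans n₀

  sortPair : ℕ → ℕ → ℕ × ℕ
  sortPair a b = if a ℕ.<ᵇ b then (a , b) else (b , a)

  sortPair-< : ∀ {a b} → a ≢ b → proj₁ (sortPair a b) < proj₂ (sortPair a b)
  sortPair-< {a} {b} ne with a <? b
  ... | yes q rewrite <ᵇ-true q = q
  ... | no q rewrite <ᵇ-false q = ≤∧≢⇒< (≮⇒≥ q) (≢-sym ne)

  sortPair-min<n : ∀ {a b} → a < n → b < n → proj₁ (sortPair a b) < n
  sortPair-min<n {a} {b} an bn with a <? b
  ... | yes q rewrite <ᵇ-true q = an
  ... | no q rewrite <ᵇ-false q = bn

  sortPair-max<n : ∀ {a b} → a < n → b < n → proj₂ (sortPair a b) < n
  sortPair-max<n {a} {b} an bn with a <? b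
  ... | yes q rewrite <ᵇ-true q = bn
  ... | no q rewrite <ᵇ-false q = an

  atPair-sortPair : ∀ U → Symmetric U → ∀ {a b} → a < n → b < n → atPair U (sortPair a b) ≡ U a b
  atPair-sortPair U su {a} {b} an bn with a <? b
  ... | yes q rewrite <ᵇ-true q = refl
  ... | no q rewrite <ᵇ-false q = su b a bn an

  exchange-sortPair : ∀ U a b c d → exchange U (a , b) (c , d) ≈ exchange U (sortPair a b) (sortPair c d)
  exchange-sortPair U a b c d x y _ _ with a <? b | c <? d
  ... | yes q | yes q' rewrite <ᵇ-true q | <ᵇ-true q' = refl
  ... | yes q | no q' rewrite <ᵇ-true q | <ᵇ-false q' = exchange-swapʳ U (a , b) c d x y
  ... | no q | yes q' rewrite <ᵇ-false q | <ᵇ-true q' = exchange-swapˡ U a b (c , d) x y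
  ... | no q | no q' rewrite <ᵇ-false q | <ᵇ-false q' = trans (exchange-swapˡ U a b (c , d) x y) (exchange-swapʳ U (b , a) c d x y)

  rotate^-next^ : ∀ r U {x y} → x < n → y < n → rotate^ r U (next^ r x) (next^ r y) ≡ U x y
  rotate^-next^ zero U _ _ = refl
  rotate^-next^ (suc r) U xn yn rewrite prev-next (next^<n r xn) | prev-next (next^<n r yn) = rotate^-next^ r U xn yn

  next^-injective : ∀ r {x y} → x < n → y < n → next^ r x ≡ next^ r y → x ≡ y
  next^-injective zero _ _ e = e
  next^-injective (suc r) xn yn e =
    next^-injective r xn yn (trans (sym (prev-next (next^<n r xn))) (trans (cong prev e) (prev-next (next^<n r yn))))

  rotate^-sym : ∀ r {U} → Symmetric U → Symmetric (rotate^ r U)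
  rotate^-sym zero su = su
  rotate^-sym (suc r) su x y xn yn = rotate^-sym r su (prev x) (prev y) (prev<n xn) (prev<n yn)

  rotate^-irrefl : ∀ r {U} → (∀ x → U x x ≡ false) → ∀ x → rotate^ r U x x ≡ false
  rotate^-irrefl zero d x = d x
  rotate^-irrefl (suc r) d x = rotate^-irrefl r d (prev x)

  Stage : ℕ → ℕ → ℕ → Edges
  Stage r g t = rotate^ r (Fan g t)

  Stage-sym : ∀ r g t → Symmetric (Stage r g t)
  Stage-sym r g t = rotate^-sym r (λ x y _ _ → Fan-sym g t x y)

  Stage-irrefl : ∀ r g t x → Stage r g t x x ≡ false
  Stage-irrefl r g t = rotate^-irrefl r (Fan-irrefl g t)

  flipLabel : ℕ → ℕ → ℕ × ℕ
  flipLabel r t = sortPair (next^ r 1) (next^ r (3 + t))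

  flipLabelᶠ : ℕ → ℕ → Fin n × Fin n
  flipLabelᶠ r t = vertex (proj₁ (flipLabel r t)) , vertex (proj₂ (flipLabel r t))

  Stage-arc : ∀ r {g t V} → 3 ≤ g → g < n → 3 + t ≤ g → V ≈ Stage r g (suc t) →
              Arc n (toDSet (Stage r g t)) (toDSet V) (flipLabelᶠ r t)
  Stage-arc r {g} {t} {V} g3 gn tg eq =
    exchange-arc tu tv (sortPair-< out≢) (sortPair-max<n (next^<n r 0<n) (next^<n r t2n))
      (sortPair-< in≢) (sortPair-max<n (next^<n r 1<n) (next^<n r t3n))
      (trans (atPair-sortPair U (Stage-sym r g t) (next^<n r 0<n) (next^<n r t2n)) (trans (rotate^-next^ r (Fan g t) 0<n t2n) (Fan-outgoing gn tg)))
      (trans (atPair-sortPair U (Stage-sym r g t) (next^<n r 1<n) (next^<n r t3n)) (trans (rotate^-next^ r (Fan g t) 1<n t3n) (Fan-incoming g3)))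
      (≈-trans eq (≈-trans (rotate^-≈ r (Fan-step g3 tg)) (≈-trans (rotate^-exchange r (Fan g t) 0<n t2n 1<n t3n) (exchange-sortPair U _ _ _ _))))
    where
    U : Edges
    U = Stage r g t
    t3n : 3 + t < n
    t3n = <-≤-trans (s≤s ≤-refl) (≤-trans (s≤s tg) gn)
    t2n : 2 + t < n
    t2n = <-trans ≤-refl t3n
    0<n : 0 < n
    0<n = s≤s z≤n
    1<n : 1 < n
    1<n = ≤-trans (s≤s (s≤s z≤n)) t3n
    out≢ : next^ r 0 ≢ next^ r (2 + t)
    out≢ e with next^-injective r 0<n t2n e
    ... | ()
    in≢ : next^ r 1 ≢ next^ r (3 + t)
    in≢ e with next^-injective r 1<n t3n e
    ... | ()
    tu : Triangulation U
    tu = Triangulation-rotate^ r (Triangulation-Fan t g3 gn (≤-trans (n≤1+n _) tg))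
    tv : Triangulation V
    tv = Triangulation-≈ (≈-sym eq) (Triangulation-rotate^ r (Triangulation-Fan (suc t) g3 gn tg))

  <∸2⇒3+≤ : ∀ g t → t < g ∸ 2 → 3 + t ≤ g
  <∸2⇒3+≤ (suc (suc g)) t q = s≤s (s≤s q)

  countLab≡count : ∀ (lab : ℕ → Fin n × Fin n) d k → countLab lab d k ≡ count (λ m → lab m ≟P d) k
  countLab≡count lab d zero = refl
  countLab≡count lab d (suc k) = cong ((if lab k ≟P d then suc zero else zero) +_) (countLab≡count lab d k)

  vertex-≟ : ∀ {x} (A : Fin n) → x < n → does (vertex x Fin.≟ A) ≡ (x ℕ.≡ᵇ toℕ A)
  vertex-≟ {x} A xn with vertex x Fin.≟ A
  ... | yes e = sym (≡ᵇ-true (trans (sym (toℕ-vertex xn)) (cong toℕ e)))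
  ... | no ne = sym (≡ᵇ-false (λ e → ne (FP.toℕ-injective (trans (toℕ-vertex xn) e))))

  -- Step m of the cycle is flip t of run j, where index m = (j , t); run j turns
  -- Stage (r j) (g j) 0 into Stage (r j) (g j) (flips j).
  module Schedule (M : ℕ) (r g : ℕ → ℕ) (g3 : ∀ j → 3 ≤ g j) (gn : ∀ j → g j < n) where
    flips : ℕ → ℕ
    flips j = g j ∸ 2

    flips≥1 : ∀ j → 0 < flips j
    flips≥1 j = ∸-monoˡ-≤ 2 (g3 j)

    step : ℕ × ℕ → ℕ × ℕ
    step (j , t) = if suc t ℕ.<ᵇ flips j then (j , suc t) else (suc j , 0)

    index : ℕ → ℕ × ℕ
    index zero = (0 , 0)
    index (suc m) = step (index m)

    start : ℕ → ℕ
    start zero = 0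
    start (suc j) = start j + flips j

    index-start : ∀ m → proj₂ (index m) < flips (proj₁ (index m)) × start (proj₁ (index m)) + proj₂ (index m) ≡ m
    index-start zero = flips≥1 0 , refl
    index-start (suc m) with index m | index-start m
    ... | (j , t) | (tl , e) with suc t <? flips j
    ...   | yes q rewrite <ᵇ-true q = q , trans (+-suc (start j) t) (cong suc e)
    ...   | no q rewrite <ᵇ-false q =
            flips≥1 (suc j) , trans (+-identityʳ _) (trans (cong (start j +_) (sym last)) (trans (+-suc (start j) t) (cong suc e)))
      where last : suc t ≡ flips j
            last = ≤-antisym tl (≮⇒≥ q)

    start-mono : ∀ {a b} → a ≤ b → start a ≤ start b
    start-mono {b = zero} z≤n = ≤-refl
    start-mono {a} {suc b} q with m≤n⇒m<n∨m≡n q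
    ... | inj₁ (s≤s a≤b) = ≤-trans (start-mono a≤b) (m≤m+n _ _)
    ... | inj₂ refl = ≤-refl

    start-injective : ∀ {j t j' t'} → t < flips j → t' < flips j' → start j + t ≡ start j' + t' → j ≡ j' × t ≡ t'
    start-injective {j} {t} {j'} {t'} tl tl' e with <-cmp j j'
    ... | tri≈ _ refl _ = refl , +-cancelˡ-≡ (start j) t t' e
    ... | tri< q _ _ = ⊥-elim (<⇒≱ (<-≤-trans (+-monoʳ-< (start j) tl) (start-mono q)) (≤-trans (m≤m+n (start j') t') (≤-reflexive (sym e))))
    ... | tri> _ _ q = ⊥-elim (<⇒≱ (<-≤-trans (+-monoʳ-< (start j') tl') (start-mono q)) (≤-trans (m≤m+n (start j) t) (≤-reflexive e)))

    index-start⁻¹ : ∀ j t → t < flips j → index (start j + t) ≡ (j , t)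
    index-start⁻¹ j t tl with index (start j + t) | index-start (start j + t)
    ... | (j' , t') | (tl' , e) with start-injective tl' tl e
    ...   | refl , refl = refl

    index-injective : ∀ {a b} → index a ≡ index b → a ≡ b
    index-injective {a} {b} e =
      trans (sym (proj₂ (index-start a))) (trans (cong (λ q → start (proj₁ q) + proj₂ q) e) (proj₂ (index-start b)))

    index-bound : ∀ m → m < start M → proj₁ (index m) < M
    index-bound m q with proj₁ (index m) <? M
    ... | yes q' = q'
    ... | no q' = ⊥-elim (<⇒≱ q (≤-trans (start-mono (≮⇒≥ q')) (≤-trans (m≤m+n _ _) (≤-reflexive (proj₂ (index-start m))))))

    cycleLength : ℕ
    cycleLength = start M

    cycleTri : ℕ → DSet n
    cycleTri m = toDSet (Stage (r (proj₁ (index m))) (g (proj₁ (index m))) (proj₂ (index m)))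

    cycleLabel : ℕ → Fin n × Fin n
    cycleLabel m = flipLabelᶠ (r (proj₁ (index m))) (proj₂ (index m))

    flip<n : ∀ {j t} → t < flips j → 3 + t < n
    flip<n {j} {t} tl = <-≤-trans (s≤s ≤-refl) (≤-trans (s≤s (<∸2⇒3+≤ (g j) t tl)) (gn j))

    flipLabel₁<n : ∀ {j t} → t < flips j → proj₁ (flipLabel (r j) t) < n
    flipLabel₁<n {j} tl = sortPair-min<n (next^<n (r j) (≤-trans (s≤s (s≤s z≤n)) (flip<n tl))) (next^<n (r j) (flip<n tl))

    flipLabel₂<n : ∀ {j t} → t < flips j → proj₂ (flipLabel (r j) t) < n
    flipLabel₂<n {j} tl = sortPair-max<n (next^<n (r j) (≤-trans (s≤s (s≤s z≤n)) (flip<n tl))) (next^<n (r j) (flip<n tl))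

    start<cycleLength : ∀ {j t} → j < M → t < flips j → start j + t < cycleLength
    start<cycleLength {j} jM tl = <-≤-trans (+-monoʳ-< (start j) tl) (start-mono jM)

    module Cycle (stages-chain : ∀ j → j < M → Stage (r j) (g j) (flips j) ≈ Stage (r (suc j)) (g (suc j)) 0)
                 (stages-close : Stage (r M) (g M) 0 ≈ Stage (r 0) (g 0) 0)
                 (stages-distinct : ∀ {j t j' t'} → j < M → t < flips j → j' < M → t' < flips j' →
                                    Stage (r j) (g j) t ≈ Stage (r j') (g j') t' → j ≡ j' × t ≡ t') where
      open ≡-Reasoning

      cycle-closes : cycleTri cycleLength ≐ cycleTri 0
      cycle-closes i j rewrite trans (cong index (sym (+-identityʳ (start M)))) (index-start⁻¹ M 0 (flips≥1 M)) = toDSet-≈ stages-close i j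

      cycle-arcs : ∀ m → m < cycleLength → Arc n (cycleTri m) (cycleTri (suc m)) (cycleLabel m)
      cycle-arcs m q with index m | index-start m | index-bound m q
      ... | (j , t) | (tl , _) | jM with suc t <? flips j
      ...   | yes qq rewrite <ᵇ-true qq = Stage-arc (r j) (g3 j) (gn j) (<∸2⇒3+≤ (g j) t tl) (λ _ _ _ _ → refl)
      ...   | no qq rewrite <ᵇ-false qq = Stage-arc (r j) (g3 j) (gn j) (<∸2⇒3+≤ (g j) t tl)
                (≈-sym (subst (λ z → Stage (r j) (g j) z ≈ Stage (r (suc j)) (g (suc j)) 0) (sym last) (stages-chain j jM)))
        where last : suc t ≡ flips j
              last = ≤-antisym tl (≮⇒≥ qq)

      cycle-distinct : ∀ i j → i < j → j < cycleLength → ¬ (cycleTri i ≐ cycleTri j)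
      cycle-distinct i j q jK e = <-irrefl (index-injective (cong₂ _,_ (proj₁ same) (proj₂ same))) q
        where
        stageAt-sym : ∀ m → Symmetric (Stage (r (proj₁ (index m))) (g (proj₁ (index m))) (proj₂ (index m)))
        stageAt-sym m = Stage-sym (r (proj₁ (index m))) (g (proj₁ (index m))) (proj₂ (index m))
        stageAt-irrefl : ∀ m x → Stage (r (proj₁ (index m))) (g (proj₁ (index m))) (proj₂ (index m)) x x ≡ false
        stageAt-irrefl m = Stage-irrefl (r (proj₁ (index m))) (g (proj₁ (index m))) (proj₂ (index m))
        same : proj₁ (index i) ≡ proj₁ (index j) × proj₂ (index i) ≡ proj₂ (index j)
        same = stages-distinct (index-bound i (<-trans q jK)) (proj₁ (index-start i)) (index-bound j jK) (proj₁ (index-start j))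
                 (toDSet-injective (stageAt-sym i) (stageAt-sym j) (λ x _ → trans (stageAt-irrefl i x) (sym (stageAt-irrefl j x))) e)

      module LabelCount (A B : Fin n) where
        isLabel : ℕ → Bool
        isLabel m = cycleLabel m ≟P (A , B)

        labelAt : ℕ → ℕ × ℕ
        labelAt m = flipLabel (r (proj₁ (index m))) (proj₂ (index m))

        isLabel-true : ∀ m → isLabel m ≡ true → labelAt m ≡ (toℕ A , toℕ B)
        isLabel-true m e rewrite vertex-≟ A (flipLabel₁<n (proj₁ (index-start m))) | vertex-≟ B (flipLabel₂<n (proj₁ (index-start m))) =
          ≡ᵇ-pair e

        isLabel-false : ∀ m → isLabel m ≡ false → labelAt m ≢ (toℕ A , toℕ B)
        isLabel-false m e e' rewrite vertex-≟ A (flipLabel₁<n (proj₁ (index-start m))) | vertex-≟ B (flipLabel₂<n (proj₁ (index-start m))) | e' =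
          false≢true (trans (sym e) (cong₂ _∧_ (≡ᵇ-true {toℕ A} refl) (≡ᵇ-true {toℕ B} refl)))

        isLabel-at : ∀ j t → t < flips j → isLabel (start j + t) ≡ false → flipLabel (r j) t ≢ (toℕ A , toℕ B)
        isLabel-at j t tl e rewrite sym (cong (λ q → flipLabel (r (proj₁ q)) (proj₂ q)) (index-start⁻¹ j t tl)) = isLabel-false (start j + t) e

        ≡start⇒≡ᵇ : ∀ m {j t} → proj₁ (index m) ≡ j → proj₂ (index m) ≡ t → (m ℕ.≡ᵇ (start j + t)) ≡ true
        ≡start⇒≡ᵇ m e1 e2 = ≡ᵇ-true (trans (sym (proj₂ (index-start m))) (cong₂ _+_ (cong start e1) e2))

      Diag⇒IsDiag : ∀ {A B} → Diag n A B → IsDiag (toℕ A) (toℕ B)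
      Diag⇒IsDiag {B = B} (q1 , q3 , q4) = q1 , FP.toℕ<n B , q3 , q4

      EachLabelOnce : Set
      EachLabelOnce = ∀ a b → IsDiag a b → Σ ℕ λ j → Σ ℕ λ t → j < M × t < flips j × flipLabel (r j) t ≡ (a , b) ×
                      (∀ j' t' → j' < M → t' < flips j' → flipLabel (r j') t' ≡ (a , b) → j' ≡ j × t' ≡ t)

      countLab-once : EachLabelOnce → ∀ A B → Diag n A B → countLab cycleLabel (A , B) cycleLength ≡ 1
      countLab-once once A B dg with once (toℕ A) (toℕ B) (Diag⇒IsDiag dg)
      ... | j1 , t1 , jM , tl , lab , unique =
        begin
          countLab cycleLabel (A , B) cycleLength       ≡⟨ countLab≡count cycleLabel (A , B) cycleLength ⟩
          count isLabel cycleLength                      ≡⟨ count-cong isLabel (λ m → m ℕ.≡ᵇ m1) cycleLength isLabel≡ ⟩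
          count (λ m → m ℕ.≡ᵇ m1) cycleLength            ≡⟨ count-≡ᵇ-one m1 cycleLength (start<cycleLength jM tl) ⟩
          1                                              ∎
        where
        open LabelCount A B
        m1 : ℕ
        m1 = start j1 + t1
        isLabel≡ : ∀ m → m < cycleLength → isLabel m ≡ (m ℕ.≡ᵇ m1)
        isLabel≡ m q with isLabel m in eb
        ... | true with unique _ _ (index-bound m q) (proj₁ (index-start m)) (isLabel-true m eb)
        ...   | e1 , e2 = sym (≡start⇒≡ᵇ m e1 e2)
        isLabel≡ m q | false with m ≟ m1
        ...   | yes refl = ⊥-elim (isLabel-at j1 t1 tl eb lab)
        ...   | no ne = sym (≡ᵇ-false ne)

      EachLabelTwice : Set
      EachLabelTwice = ∀ a b → IsDiag a b → Σ ℕ λ j1 → Σ ℕ λ t1 → Σ ℕ λ j2 → Σ ℕ λ t2 →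
                       (j1 < M × t1 < flips j1) × (j2 < M × t2 < flips j2) × flipLabel (r j1) t1 ≡ (a , b) × flipLabel (r j2) t2 ≡ (a , b) ×
                       ¬ (j1 ≡ j2 × t1 ≡ t2) ×
                       (∀ j' t' → j' < M → t' < flips j' → flipLabel (r j') t' ≡ (a , b) → (j' ≡ j1 × t' ≡ t1) ⊎ (j' ≡ j2 × t' ≡ t2))

      countLab-twice : EachLabelTwice → ∀ A B → Diag n A B → countLab cycleLabel (A , B) cycleLength ≡ 2
      countLab-twice twice A B dg with twice (toℕ A) (toℕ B) (Diag⇒IsDiag dg)
      ... | j1 , t1 , j2 , t2 , (jM1 , tl1) , (jM2 , tl2) , lab1 , lab2 , distinct , unique =
        begin
          countLab cycleLabel (A , B) cycleLength       ≡⟨ countLab≡count cycleLabel (A , B) cycleLength ⟩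
          count isLabel cycleLength                      ≡⟨ count-cong isLabel (λ m → (m ℕ.≡ᵇ m1) ∨ (m ℕ.≡ᵇ m2)) cycleLength isLabel≡ ⟩
          count (λ m → (m ℕ.≡ᵇ m1) ∨ (m ℕ.≡ᵇ m2)) cycleLength
                                                         ≡⟨ count-∨ m1 m2 cycleLength m1≢m2 ⟩
          count (λ m → m ℕ.≡ᵇ m1) cycleLength + count (λ m → m ℕ.≡ᵇ m2) cycleLength
                                                         ≡⟨ cong₂ _+_ (count-≡ᵇ-one m1 cycleLength (start<cycleLength jM1 tl1))
                                                                      (count-≡ᵇ-one m2 cycleLength (start<cycleLength jM2 tl2)) ⟩
          2                                              ∎
        where
        open LabelCount A B
        m1 m2 : ℕ
        m1 = start j1 + t1
        m2 = start j2 + t2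
        m1≢m2 : m1 ≢ m2
        m1≢m2 e = distinct (start-injective tl1 tl2 e)
        isLabel≡ : ∀ m → m < cycleLength → isLabel m ≡ ((m ℕ.≡ᵇ m1) ∨ (m ℕ.≡ᵇ m2))
        isLabel≡ m q with isLabel m in eb
        ... | true with unique _ _ (index-bound m q) (proj₁ (index-start m)) (isLabel-true m eb)
        ...   | inj₁ (e1 , e2) rewrite ≡start⇒≡ᵇ m e1 e2 = refl
        ...   | inj₂ (e1 , e2) rewrite ≡start⇒≡ᵇ m e1 e2 = sym (∨-zeroʳ _)
        isLabel≡ m q | false with m ≟ m1 | m ≟ m2
        ...   | yes refl | _ = ⊥-elim (isLabel-at j1 t1 tl1 eb lab1)
        ...   | _ | yes refl = ⊥-elim (isLabel-at j2 t2 tl2 eb lab2)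
        ...   | no n1 | no n2 rewrite ≡ᵇ-false n1 | ≡ᵇ-false n2 = refl

      rainbow-once : EachLabelOnce → RainbowCycle n 1
      rainbow-once once = cycleLength , cycleTri , cycleLabel , cycle-closes , cycle-arcs , cycle-distinct , countLab-once once

      rainbow-twice : EachLabelTwice → RainbowCycle n 2
      rainbow-twice twice = cycleLength , cycleTri , cycleLabel , cycle-closes , cycle-arcs , cycle-distinct , countLab-twice twice

module FanRotation (n₀ : ℕ) where
  open Polygon n₀
  open Fans n₀
  open Schedules n₀

  prev^ : ℕ → ℕ → ℕ
  prev^ zero x = x
  prev^ (suc r) x = prev^ r (prev x)

  prev^<n : ∀ r {x} → x < n → prev^ r x < n
  prev^<n zero q = q
  prev^<n (suc r) q = prev^<n r (prev<n q)

  prev^+≡ₙ : ∀ r {x} → x < n → (prev^ r x + r) ≡ₙ x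
  prev^+≡ₙ zero {x} q = ≡⇒≡ₙ (+-identityʳ x)
  prev^+≡ₙ (suc r) {x} q =
    ≡ₙ-trans (≡⇒≡ₙ (+-suc (prev^ r (prev x)) r)) (≡ₙ-trans (≡ₙ-suc (prev^+≡ₙ r (prev<n q))) (suc-prev≡ₙ q))

  rotate^-prev^ : ∀ r U x y → rotate^ r U x y ≡ U (prev^ r x) (prev^ r y)
  rotate^-prev^ zero U x y = refl
  rotate^-prev^ (suc r) U x y = rotate^-prev^ r U (prev x) (prev y)

  next^≡ₙ+ : ∀ r {x} → next^ r x ≡ₙ (x + r)
  next^≡ₙ+ zero {x} = ≡⇒≡ₙ (sym (+-identityʳ x))
  next^≡ₙ+ (suc r) {x} = ≡ₙ-trans (next≡ₙsuc (next^ r x)) (≡ₙ-trans (≡ₙ-suc (next^≡ₙ+ r)) (≡⇒≡ₙ (sym (+-suc x r))))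

  next^-≡ : ∀ j x {y} → x < n → y < n → (x + j) ≡ₙ y → next^ j x ≡ y
  next^-≡ j x xn yn e = ≡ₙ⇒≡ (next^<n j xn) yn (≡ₙ-trans (next^≡ₙ+ j) e)

  next^-≡⁻¹ : ∀ j x {y} → next^ j x ≡ y → (x + j) ≡ₙ y
  next^-≡⁻¹ j x refl = ≡ₙ-sym (next^≡ₙ+ j)

  gap< : ∀ {m δ} a → n ≡ 3 + m → 2 + a + δ < n → ¬ (a ≡ 0 × suc (2 + a + δ) ≡ n) → δ < m
  gap< {δ = δ} zero nE q nt = ≤-pred (≤-pred (≤-pred (subst (4 + δ ≤_) nE (≤∧≢⇒< q (λ e → nt (refl , e))))))
  gap< {δ = δ} (suc a) nE q _ = ≤-trans (s≤s (m≤n+m δ a)) (≤-pred (≤-pred (≤-pred (subst (4 + a + δ ≤_) nE q))))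

  +≡⇒≤ : ∀ {a b} k → a + k ≡ b → a ≤ b
  +≡⇒≤ {a} k eq = subst (a ≤_) eq (m≤m+n a k)

  ≤⇒∃+ : ∀ {a b} → a ≤ b → Σ ℕ λ k → b ≡ a + k
  ≤⇒∃+ q = let (k , e) = m≤n⇒∃[o]m+o≡n q in k , sym e

  prev^-≡ : ∀ g {x X} → X < n → x < n → (X + g) ≡ₙ x → prev^ g x ≡ X
  prev^-≡ g Xn xn e = ≡ₙ-cancelʳ⇒≡ g (prev^<n g xn) Xn (≡ₙ-trans (prev^+≡ₙ g xn) (≡ₙ-sym e))

  prev^-≡⁻¹ : ∀ g {x X w} → x < n → w < n → prev^ g x ≡ X → (X + g) ≡ₙ w → x ≡ w
  prev^-≡⁻¹ g {x} xn wn refl e = ≡ₙ⇒≡ xn wn (≡ₙ-trans (≡ₙ-sym (prev^+≡ₙ g xn)) e)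

  InFan± : ℕ → ℕ → ℕ → ℕ → Set
  InFan± g t x y = InFan g t x y ⊎ InFan g t y x

  Fan-cong : ∀ {g t x y g' t' x' y'} → (InFan± g t x y → InFan± g' t' x' y') → (InFan± g' t' x' y' → InFan± g t x y) → Fan g t x y ≡ Fan g' t' x' y'
  Fan-cong {g} {t} {x} {y} {g'} {t'} {x'} {y'} f h = does-⇔ (inFan? g t x y ⊎-dec inFan? g t y x) (inFan? g' t' x' y' ⊎-dec inFan? g' t' y' x') f h

  InFan±-swap : ∀ {g t x y} → InFan± g t x y → InFan± g t y x
  InFan±-swap (inj₁ q) = inj₂ q
  InFan±-swap (inj₂ q) = inj₁ q

  private
    E1 : ∀ a b → (2 + b) + (2 + a) ≡ 1 + (3 + (a + b))
    E1 = solve-∀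
    E2 : ∀ a b k → (4 + b + k) + (2 + a) ≡ (3 + k) + (3 + (a + b))
    E2 = solve-∀
    E3 : ∀ a b → (1 + b) + (2 + a) ≡ 0 + (3 + (a + b))
    E3 = solve-∀
    E4 : ∀ a k → (2 + k) + (2 + a) ≡ (2 + (2 + a)) + k
    E4 = solve-∀

  module FanJoin (a b : ℕ) (e : n₀ ≡ 2 + (a + b)) where
    nE : n ≡ 3 + (a + b)
    nE = cong suc e
    g g' : ℕ
    g = 2 + a
    g' = 2 + b
    <n : ∀ {u} → u < 3 + (a + b) → u < n
    <n {u} q = subst (λ z → u < z) (sym nE) q
    n< : ∀ {u} → u < n → u < 3 + (a + b)
    n< {u} q = subst (λ z → u < z) nE q
    0<n : 0 < n
    0<n = s≤s z≤n
    g<n : g < n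
    g<n = <n (s≤s (s≤s (s≤s (m≤m+n a b))))
    g'<n : g' < n
    g'<n = <n (s≤s (s≤s (s≤s (m≤n+m b a))))

    prev^-1 : prev^ g 1 ≡ g'
    prev^-1 = prev^-≡ g {1} {g'} g'<n (<-trans (s≤s (s≤s z≤n)) g<n) (≡+n⇒≡ₙ (trans (E1 a b) (cong (1 +_) (sym nE))))
    prev^-g : prev^ g g ≡ 0
    prev^-g = prev^-≡ g {g} {0} 0<n g<n (≡⇒≡ₙ refl)
    prev^-0 : prev^ g 0 ≡ 1 + b
    prev^-0 = prev^-≡ g {0} {1 + b} (<-trans ≤-refl g'<n) 0<n (≡+n⇒≡ₙ (trans (E3 a b) (cong (0 +_) (sym nE))))

    private
      F1 : ∀ b a' → 4 + b + a' ≡ 3 + ((1 + a') + b)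
      F1 = solve-∀
      F2 : ∀ k w → 2 + (2 + k + w) ≡ suc (3 + k) + w
      F2 = solve-∀
      F3 : ∀ b k w → suc (4 + b + k) + w ≡ 3 + ((2 + k + w) + b)
      F3 = solve-∀
      F4 : ∀ a w → 4 + a + w ≡ 3 + a + (1 + w)
      F4 = solve-∀
      F5 : ∀ a b → 3 + (a + b) ≡ 3 + a + b
      F5 = solve-∀
      F6 : ∀ a k w → suc (2 + (2 + a) + k) + w ≡ 3 + a + (2 + k + w)
      F6 = solve-∀
      F7 : ∀ a k w → 4 + k + (1 + a + w) ≡ 3 + (a + (2 + k + w))
      F7 = solve-∀
      F8 : ∀ b a → 3 + b + a ≡ 3 + (a + b)
      F8 = solve-∀
      F9 : ∀ k w → 2 + k + (2 + w) ≡ 2 + (2 + k + w)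
      F9 = solve-∀

    cancel2 : ∀ {u v} → 2 + u ≡ 2 + v → u ≡ v
    cancel2 refl = refl

    InFan-prev^ : ∀ {x y} → x < n → y < n → InFan g a x y → InFan± g' 0 (prev^ g x) (prev^ g y)
    InFan-prev^ {x} {y} xn yn (inj₁ (refl , y3 , ya)) with y ≟ g
    ... | yes refl = subst₂ (InFan± g' 0) (sym prev^-1) (sym prev^-g) (inj₂ (inj₂ (inj₁ (refl , s≤s (s≤s z≤n) , ≤-refl , i1))))
      where
      i1 : 2 + (2 + b) ≤ n
      i1 with ≤⇒∃+ (≤-pred (≤-pred y3))
      ... | a' , ea = subst (4 + b ≤_) (sym nE) (+≡⇒≤ a' (trans (F1 b a') (cong (λ z → 3 + (z + b)) (sym ea))))
    ... | no ne with ≤⇒∃+ y3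
    ...   | k , refl with ≤⇒∃+ (≤∧≢⇒< ya ne)
    ...     | w , ew = subst (InFan± g' 0 (prev^ g 1)) (sym PY) (subst (λ z → InFan± g' 0 z (4 + b + k)) (sym prev^-1)
                          (inj₁ (inj₂ (inj₂ (refl , m≤m+n (2 + (2 + b)) k , Yn)))))
      where
      ea : a ≡ 2 + k + w
      ea = cancel2 (trans ew (sym (F2 k w)))
      Yn : 4 + b + k < n
      Yn = <n (+≡⇒≤ w (trans (F3 b k w) (cong (λ z → 3 + (z + b)) (sym ea))))
      PY : prev^ g (3 + k) ≡ 4 + b + k
      PY = prev^-≡ g {3 + k} {4 + b + k} Yn yn (≡+n⇒≡ₙ (trans (E2 a b k) (cong ((3 + k) +_) (sym nE))))
    InFan-prev^ {x} {y} xn yn (inj₂ (inj₁ (refl , ay , ya , y2n))) with ≤-antisym ya ay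
    ... | refl = subst₂ (InFan± g' 0) (sym prev^-0) (sym prev^-g) (inj₂ (inj₂ (inj₁ (refl , s≤s b1 , n≤1+n _ , i2))))
      where
      b1 : 1 ≤ b
      b1 with ≤⇒∃+ (subst (4 + a ≤_) nE y2n)
      ... | w , ew = subst (1 ≤_) (sym (+-cancelˡ-≡ (3 + a) b (1 + w) (trans (sym (F5 a b)) (trans ew (F4 a w))))) (s≤s z≤n)
      i2 : 2 + (1 + b) ≤ n
      i2 = subst (3 + b ≤_) (sym nE) (+≡⇒≤ a (F8 b a))
    InFan-prev^ {x} {y} xn yn (inj₂ (inj₂ (refl , gy , yn'))) with ≤⇒∃+ gy
    ... | k , refl with ≤⇒∃+ (n< yn)
    ...   | w , ew = subst₂ (InFan± g' 0) (sym prev^-g) (sym PY) (inj₁ (inj₂ (inj₁ (refl , m≤m+n 2 k , i3 , i4))))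
      where
      eb : b ≡ 2 + k + w
      eb = +-cancelˡ-≡ (3 + a) b (2 + k + w) (trans (sym (F5 a b)) (trans ew (F6 a k w)))
      i3 : 2 + k ≤ 2 + b
      i3 = subst (λ z → 2 + k ≤ 2 + z) (sym eb) (+≡⇒≤ (2 + w) (F9 k w))
      i4 : 2 + (2 + k) ≤ n
      i4 = subst (4 + k ≤_) (sym nE) (+≡⇒≤ (1 + a + w) (trans (F7 a k w) (cong (λ z → 3 + (a + z)) (sym eb))))
      PY : prev^ g (2 + (2 + a) + k) ≡ 2 + k
      PY = prev^-≡ g {2 + (2 + a) + k} {2 + k} (≤-trans (n≤1+n _) i4) yn (≡⇒≡ₙ (E4 a k))

    private
      G1 : ∀ a b w → 4 + a + w ≡ 3 + (a + (1 + w))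
      G1 = solve-∀
      G2 : ∀ b Z w → suc (2 + (2 + b) + Z) + w ≡ 3 + ((2 + Z + w) + b)
      G2 = solve-∀
      G3 : ∀ Z w b → 4 + Z + (1 + w + b) ≡ 3 + ((2 + Z + w) + b)
      G3 = solve-∀
      G4 : ∀ Z w → 3 + Z + (1 + w) ≡ 2 + (2 + Z + w)
      G4 = solve-∀
      G5 : ∀ b w → 4 + b + w ≡ 3 + ((1 + w) + b)
      G5 = solve-∀
      G7 : ∀ a b → (2 + a) + (1 + b) ≡ 3 + (a + b)
      G7 = solve-∀

    InFan-prev^⁻¹ : ∀ {x y X Y} → InFan g' 0 X Y → prev^ g x ≡ X → prev^ g y ≡ Y → x < n → y < n → InFan± g a x y
    InFan-prev^⁻¹ (inj₁ (_ , q , r)) _ _ _ _ = ⊥-elim (<-irrefl refl (≤-trans q r))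
    InFan-prev^⁻¹ {x} {y} {X} {Y} (inj₂ (inj₂ (refl , gY , Yn))) ex' ey xn yn with ≤⇒∃+ gY
    ... | Z , refl with ≤⇒∃+ (n< Yn)
    ...   | w , ew = subst₂ (InFan± g a) (sym xv) (sym yv) (inj₁ (inj₁ (refl , m≤m+n 3 Z , subst (λ z → 3 + Z ≤ 2 + z) (sym ea) (+≡⇒≤ (1 + w) (G4 Z w)))))
      where
      ea : a ≡ 2 + Z + w
      ea = +-cancelʳ-≡ b a (2 + Z + w) (+-cancelˡ-≡ 3 _ _ (trans ew (G2 b Z w)))
      xv : x ≡ 1
      xv = prev^-≡⁻¹ g xn (<-trans (s≤s (s≤s z≤n)) g<n) ex' (≡+n⇒≡ₙ (trans (E1 a b) (cong (1 +_) (sym nE))))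
      Zn : 3 + Z < n
      Zn = <n (+≡⇒≤ (1 + w + b) (trans (G3 Z w b) (cong (λ z → 3 + (z + b)) (sym ea))))
      yv : y ≡ 3 + Z
      yv = prev^-≡⁻¹ g yn Zn ey (≡+n⇒≡ₙ (trans (E2 a b Z) (cong ((3 + Z) +_) (sym nE))))
    InFan-prev^⁻¹ {x} {y} {X} {Y} (inj₂ (inj₁ (refl , Y2 , Yb , Y2n))) ex' ey xn yn with prev^-≡⁻¹ g {x} {0} {g} xn g<n ex' (≡⇒≡ₙ refl)
    ... | refl with <-cmp Y (1 + b)
    ...   | tri< q _ _ = inj₁ (inj₂ (inj₂ (refl , subst (2 + g ≤_) (sym yv) (+-monoˡ-≤ g Y2) , subst (_< n) (sym yv) Ygn)))
      where
      Ygn : Y + g < n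
      Ygn = <n (≤-trans (+-monoˡ-≤ g q) (≤-reflexive (trans (+-comm (1 + b) g) (G7 a b))))
      yv : y ≡ Y + g
      yv = prev^-≡⁻¹ g yn Ygn ey (≡⇒≡ₙ refl)
    ...   | tri≈ _ refl _ = subst (InFan± g a g) (sym yv) (inj₂ (inj₂ (inj₁ (refl , ≤-refl , ≤-refl , i5))))
      where
      yv : y ≡ 0
      yv = prev^-≡⁻¹ g yn 0<n ey (≡+n⇒≡ₙ (trans (E3 a b) (cong (0 +_) (sym nE))))
      i5 : 2 + g ≤ n
      i5 with ≤⇒∃+ (≤-pred Y2)
      ... | w , ew = subst (4 + a ≤_) (sym nE) (+≡⇒≤ w (trans (G1 a b w) (cong (λ z → 3 + (a + z)) (sym ew))))
    ...   | tri> _ _ q with ≤-antisym Yb q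
    ...     | refl = subst (InFan± g a g) (sym yv) (inj₂ (inj₁ (refl , a1 , ≤-refl)))
      where
      yv : y ≡ 1
      yv = prev^-≡⁻¹ g yn (<-trans (s≤s (s≤s z≤n)) g<n) ey (≡+n⇒≡ₙ (trans (E1 a b) (cong (1 +_) (sym nE))))
      a1 : 3 ≤ 2 + a
      a1 with ≤⇒∃+ (subst (4 + b ≤_) nE Y2n)
      ... | w , ew = s≤s (s≤s (subst (1 ≤_) (sym (+-cancelʳ-≡ b a (1 + w) (+-cancelˡ-≡ 3 _ _ (trans ew (G5 b w))))) (s≤s z≤n)))

    Fan-last≈rotate^-Fan-first : Fan g a ≈ rotate^ g (Fan g' 0)
    Fan-last≈rotate^-Fan-first x y xn yn = trans (Fan-cong F H) (sym (rotate^-prev^ g (Fan g' 0) x y))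
      where
      F : InFan± g a x y → InFan± g' 0 (prev^ g x) (prev^ g y)
      F (inj₁ q) = InFan-prev^ xn yn q
      F (inj₂ q) = InFan±-swap (InFan-prev^ yn xn q)
      H : InFan± g' 0 (prev^ g x) (prev^ g y) → InFan± g a x y
      H (inj₁ q) = InFan-prev^⁻¹ q refl refl xn yn
      H (inj₂ q) = InFan±-swap (InFan-prev^⁻¹ q refl refl yn xn)

  rotate^-+ : ∀ a b U → rotate^ a (rotate^ b U) ≡ rotate^ (a + b) U
  rotate^-+ zero b U = refl
  rotate^-+ (suc a) b U = cong rotate (rotate^-+ a b U)

  prev^-≡ₙ : ∀ {r r' x} → r ≡ₙ r' → x < n → prev^ r x ≡ prev^ r' x
  prev^-≡ₙ {r} {r'} {x} e xn = ≡ₙ-cancelʳ⇒≡ r (prev^<n r xn) (prev^<n r' xn)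
    (≡ₙ-trans (prev^+≡ₙ r xn) (≡ₙ-trans (≡ₙ-sym (prev^+≡ₙ r' xn)) (≡ₙ-trans (≡⇒≡ₙ (+-comm (prev^ r' x) r')) (≡ₙ-trans (≡ₙ-+ʳ (prev^ r' x) (≡ₙ-sym e)) (≡⇒≡ₙ (+-comm r (prev^ r' x)))))))

  rotate^-≡ₙ : ∀ {r r'} U → r ≡ₙ r' → rotate^ r U ≈ rotate^ r' U
  rotate^-≡ₙ {r} {r'} U e x y xn yn rewrite rotate^-prev^ r U x y | rotate^-prev^ r' U x y | prev^-≡ₙ e xn | prev^-≡ₙ e yn = refl

  prev^-next^ : ∀ r {w} → w < n → prev^ r (next^ r w) ≡ w
  prev^-next^ r {w} wn = ≡ₙ-cancelʳ⇒≡ r (prev^<n r (next^<n r wn)) wn (≡ₙ-trans (prev^+≡ₙ r (next^<n r wn)) (next^≡ₙ+ r))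

  next² : ℕ → ℕ
  next² v = next (next v)

  next²≡ₙ+2 : ∀ v → next² v ≡ₙ (v + 2)
  next²≡ₙ+2 v = ≡ₙ-trans (next≡ₙsuc (next v)) (≡ₙ-trans (≡⇒≡ₙ (+-comm 1 (next v))) (≡ₙ-trans (≡ₙ-+ʳ 1 (next≡ₙsuc v)) (≡⇒≡ₙ (solve1 v))))
    where solve1 : ∀ v → suc v + 1 ≡ v + 2
          solve1 = solve-∀

  prev^-next² : ∀ r {v} → v < n → prev^ r (next² v) ≡ next² (prev^ r v)
  prev^-next² r {v} vn = ≡ₙ-cancelʳ⇒≡ r (prev^<n r (next<n (next v))) (next<n (next (prev^ r v)))
    (≡ₙ-trans (prev^+≡ₙ r (next<n (next v))) (≡ₙ-trans (next²≡ₙ+2 v) (≡ₙ-trans (≡ₙ-+ʳ 2 (≡ₙ-sym (prev^+≡ₙ r vn))) (≡ₙ-trans (≡⇒≡ₙ (solve2 (prev^ r v) r)) (≡ₙ-sym (≡ₙ-+ʳ r (next²≡ₙ+2 (prev^ r v))))))))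
    where solve2 : ∀ u r → u + r + 2 ≡ u + 2 + r
          solve2 = solve-∀

  rotate^-cancel : ∀ r {A B} → rotate^ r A ≈ rotate^ r B → A ≈ B
  rotate^-cancel r {A} {B} e x y xn yn = trans (sym (rotate^-next^ r A xn yn)) (trans (e _ _ (next^<n r xn) (next^<n r yn)) (rotate^-next^ r B xn yn))

  HasEar : Edges → ℕ → Bool
  HasEar U w = U w (next² w)

  HasEar-rotate^ : ∀ r U {v} → v < n → HasEar (rotate^ r U) v ≡ HasEar U (prev^ r v)
  HasEar-rotate^ r U {v} vn rewrite rotate^-prev^ r U v (next² v) | prev^-next² r vn = refl

  HasEar-≈ : ∀ {U V} → U ≈ V → ∀ {v} → v < n → HasEar U v ≡ HasEar V v
  HasEar-≈ e {v} vn = e v (next² v) vn (next<n (next v))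

  next²-small : ∀ {w} → w + 2 < n → next² w ≡ w + 2
  next²-small {w} q = ≡ₙ⇒≡ (next<n _) q (next²≡ₙ+2 w)
  next²-wrap : ∀ {w c} → w + 2 ≡ c + n → c < n → next² w ≡ c
  next²-wrap {w} eq cn = ≡ₙ⇒≡ (next<n _) cn (≡ₙ-trans (next²≡ₙ+2 w) (≡+n⇒≡ₙ eq))

  FanEar : ℕ → ℕ → ℕ → Set
  FanEar g t w = (w ≡ 0 × t ≡ 0) ⊎ (w ≡ 1 × 1 ≤ t) ⊎ (w ≡ g × g + 3 ≤ n) ⊎ (w + 2 ≡ n × n ≤ g + 2 × t + 4 ≤ n) ⊎ (w + 1 ≡ n × n ≤ t + 3)

  Fan-ear-cases : ∀ {g t w} → 4 ≤ n → w < n → 2 ≤ g → HasEar (Fan g t) w ≡ true → FanEar g t w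
  Fan-ear-cases {g} {t} {w} n4 wn g2 e with <-cmp (w + 2) n
  ... | tri< q _ _ = go (Fan-true⇒ {g} {t} (m<m+n w (s≤s z≤n)) (subst (λ z → Fan g t w z ≡ true) (next²-small q) e))
    where
    go : InFan g t w (w + 2) → FanEar g t w
    go (inj₁ (refl , _ , r)) = inj₂ (inj₁ (refl , ≤-pred (≤-pred r)))
    go (inj₂ (inj₁ (refl , r , _))) = inj₁ (refl , n≤0⇒n≡0 (≤-pred (≤-pred r)))
    go (inj₂ (inj₂ (refl , _ , _))) = inj₂ (inj₂ (inj₁ (refl , subst (_≤ n) (solve3 g) q)))
      where solve3 : ∀ g → suc (g + 2) ≡ g + 3
            solve3 = solve-∀
  ... | tri≈ _ q _ = go (Fan-true⇒ {g} {t} w0 (trans (Fan-sym g t 0 w) (subst (λ z → Fan g t w z ≡ true) (next²-wrap (trans q (sym (+-identityˡ n))) (s≤s z≤n)) e)))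
    where
    w0 : 0 < w
    w0 = lem q n4
      where lem : ∀ {w} → w + 2 ≡ n → 4 ≤ n → 0 < w
            lem {zero} e n4' with subst (4 ≤_) (sym e) n4'
            ... | s≤s (s≤s ())
            lem {suc w} _ _ = s≤s z≤n
    S2 : ∀ t → 2 + t + 2 ≡ t + 4
    S2 = solve-∀
    go : InFan g t 0 w → FanEar g t w
    go (inj₁ (() , _))
    go (inj₂ (inj₁ (_ , r1 , r2 , _))) = inj₂ (inj₂ (inj₂ (inj₁ (q , subst (_≤ g + 2) q (+-monoˡ-≤ 2 r2) , subst (t + 4 ≤_) q (subst (_≤ w + 2) (S2 t) (+-monoˡ-≤ 2 r1))))))
    go (inj₂ (inj₂ (e0 , _))) = ⊥-elim (<-irrefl e0 (≤-trans (s≤s z≤n) g2))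
  ... | tri> _ _ q = go (Fan-true⇒ {g} {t} w1 (trans (Fan-sym g t 1 w) (subst (λ z → Fan g t w z ≡ true) (next²-wrap eq1 (≤-trans (s≤s (s≤s z≤n)) n4)) e)))
    where
    eq1 : w + 2 ≡ 1 + n
    eq1 = ≤-antisym (subst (_≤ suc n) (+-comm 2 w) (s≤s wn)) q
    w1n : w + 1 ≡ n
    w1n = suc-injective (trans (sym (+-suc w 1)) eq1)
    w1 : 1 < w
    w1 = ≤-trans (s≤s (s≤s z≤n)) (≤-pred (subst (4 ≤_) (trans (sym w1n) (+-comm w 1)) n4))
    S1 : ∀ t → 2 + t + 1 ≡ t + 3
    S1 = solve-∀
    go : InFan g t 1 w → FanEar g t w
    go (inj₁ (_ , r1 , r2)) = inj₂ (inj₂ (inj₂ (inj₂ (w1n , subst (_≤ t + 3) w1n (subst (w + 1 ≤_) (S1 t) (+-monoˡ-≤ 1 r2))))))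
    go (inj₂ (inj₁ (() , _)))
    go (inj₂ (inj₂ (e1 , _))) = ⊥-elim (<-irrefl e1 g2)

  Fan-ear-1 : ∀ {g t} → 4 ≤ n → 1 ≤ t → HasEar (Fan g t) 1 ≡ true
  Fan-ear-1 {g} {t} n4 t1 = subst (λ z → Fan g t 1 z ≡ true) (sym (next²-small n4)) (Fan-intro {g} {t} (s≤s (s≤s z≤n)) (inj₁ (refl , ≤-refl , s≤s (s≤s t1))))
  Fan-ear-0 : ∀ {g} → 4 ≤ n → 2 ≤ g → HasEar (Fan g 0) 0 ≡ true
  Fan-ear-0 {g} n4 g2 = subst (λ z → Fan g 0 0 z ≡ true) (sym (next²-small (≤-trans (s≤s (s≤s (s≤s z≤n))) n4))) (Fan-intro {g} {0} (s≤s z≤n) (inj₂ (inj₁ (refl , ≤-refl , g2 , n4))))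
  Fan-ear-g : ∀ {g t} → 2 + t ≤ g → g + 3 ≤ n → HasEar (Fan g t) g ≡ true
  Fan-ear-g {g} {t} tg q = subst (λ z → Fan g t g z ≡ true) (sym (next²-small q')) (Fan-intro {g} {t} (m<m+n g (s≤s z≤n)) (inj₂ (inj₂ (refl , ≤-reflexive (+-comm 2 g) , q'))))
    where q' : g + 2 < n
          q' = subst (_≤ n) (+-suc g 2) q
  Fan-ear-last : ∀ {g t w} → w + 2 ≡ n → w ≤ g → 2 + t ≤ w → HasEar (Fan g t) w ≡ true
  Fan-ear-last {g} {t} {w} e wg tw = subst (λ z → Fan g t w z ≡ true) (sym (next²-wrap (trans e (sym (+-identityˡ n))) (s≤s z≤n)))
      (trans (Fan-sym g t w 0) (Fan-intro {g} {t} (≤-trans (s≤s z≤n) tw) (inj₂ (inj₁ (refl , tw , wg , ≤-reflexive (trans (+-comm 2 w) e))))))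

  Fan-ear-g′ : ∀ {g t} → 2 + t ≤ g → g + 2 ≤ n → HasEar (Fan g t) g ≡ true
  Fan-ear-g′ {g} {t} tg g2 with g + 3 ≤? n
  ... | yes q = Fan-ear-g tg q
  ... | no q = Fan-ear-last (≤-antisym g2 (≤-pred (subst (suc n ≤_) (+-suc g 2) (≰⇒> q)))) ≤-refl tg

  Fan-injective : ∀ {G t t'} → 3 ≤ G → G < n → 2 + t ≤ G → 2 + t' ≤ G → Fan G t ≈ Fan G t' → t ≡ t'
  Fan-injective {G} {t} {t'} g3 gn tg tg' e with <-cmp t t'
  ... | tri≈ _ q _ = q
  ... | tri< q _ _ = ⊥-elim (false≢true (trans (sym (Fan-incoming {G} {t} g3)) (trans (e 1 (3 + t) (≤-trans (s≤s (s≤s z≤n)) t3n) t3n)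
                       (Fan-intro {G} {t'} (s≤s (s≤s z≤n)) (inj₁ (refl , m≤m+n 3 t , s≤s (s≤s q)))))))
    where t3n : 3 + t < n
          t3n = ≤-trans (s≤s (s≤s (s≤s q))) (≤-trans (s≤s tg') gn)
  ... | tri> _ _ q = ⊥-elim (false≢true (trans (sym (Fan-incoming {G} {t'} g3)) (trans (sym (e 1 (3 + t') (≤-trans (s≤s (s≤s z≤n)) t3n) t3n))
                       (Fan-intro {G} {t} (s≤s (s≤s z≤n)) (inj₁ (refl , m≤m+n 3 t' , s≤s (s≤s q)))))))
    where t3n : 3 + t' < n
          t3n = ≤-trans (s≤s (s≤s (s≤s q))) (≤-trans (s≤s tg) gn)

  prev^-next^-≡ₙ : ∀ j' j {u} → u < n → (prev^ j' (next^ j u) + j') ≡ₙ (u + j)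
  prev^-next^-≡ₙ j' j un = ≡ₙ-trans (prev^+≡ₙ j' (next^<n j un)) (next^≡ₙ+ j)

  sortPair-cases : ∀ {u v a b} → sortPair u v ≡ (a , b) → (u ≡ a × v ≡ b) ⊎ (u ≡ b × v ≡ a)
  sortPair-cases {u} {v} e with u ℕ.<ᵇ v
  ... | true = inj₁ (cong proj₁ e , cong proj₂ e)
  ... | false = inj₂ (cong proj₂ e , cong proj₁ e)

  sortPair-<′ : ∀ {a b} → a < b → sortPair a b ≡ (a , b)
  sortPair-<′ q rewrite <ᵇ-true q = refl
  sortPair->′ : ∀ {a b} → b < a → sortPair a b ≡ (b , a)
  sortPair->′ q rewrite <ᵇ-false (<⇒≯ q) = refl

  -- The diagonal {x , x + 2 + δ} is inserted by flip δ of a run rotated by x - 1, and by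
  -- flip w of a run rotated by x + 1 + δ, where δ + w + 1 = n - 3; by no other flip.
  module DiagonalLabels {m x δ w : ℕ} (nE : n ≡ 3 + m) (ew : m ≡ suc δ + w) (yn : 2 + x + δ < n) where
    y : ℕ
    y = 2 + x + δ

    xy : x < y
    xy = s≤s (≤-trans (m≤m+n x δ) (n≤1+n _))

    xn : x < n
    xn = <-trans xy yn

    δ<m : δ < m
    δ<m = subst (δ <_) (sym ew) (s≤s (m≤m+n δ w))

    w<m : w < m
    w<m = subst (w <_) (sym ew) (s≤s (m≤n+m w δ))

    <m⇒<n : ∀ {u} → u < m → u < n
    <m⇒<n {u} q = subst (u <_) (sym nE) (≤-trans q (≤-trans (n≤1+n _) (≤-trans (n≤1+n _) (n≤1+n _))))

    private
      1<n : 1 < n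
      1<n = ≤-trans (s≤s (s≤s z≤n)) (≤-trans (s≤s (s≤s z≤n)) yn)
      3+<n : ∀ {u} → u < m → 3 + u < n
      3+<n {u} q = subst (3 + u <_) (sym nE) (s≤s (s≤s (s≤s q)))
      shift : ∀ d p → 3 + d + p ≡ suc p + (2 + d)
      shift = solve-∀
      reassoc : ∀ a d → a + (2 + d) ≡ 2 + a + d
      reassoc = solve-∀
      around : ∀ a d w → (2 + w) + (2 + a + d) ≡ a + (3 + (suc d + w))
      around = solve-∀

    before≡ₙ : (3 + δ + prev x) ≡ₙ y
    before≡ₙ = ≡ₙ-trans (≡⇒≡ₙ (shift δ (prev x))) (≡ₙ-trans (≡ₙ-+ʳ (2 + δ) (suc-prev≡ₙ xn)) (≡⇒≡ₙ (reassoc x δ)))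

    after≡ₙ : (3 + w + prev y) ≡ₙ x
    after≡ₙ = ≡ₙ-trans (≡⇒≡ₙ (shift w (prev y))) (≡ₙ-trans (≡ₙ-+ʳ (2 + w) (suc-prev≡ₙ yn))
      (≡ₙ-trans (≡⇒≡ₙ (trans (+-comm y (2 + w)) (trans (around x δ w) (trans (cong (λ z → x + (3 + z)) (sym ew)) (cong (x +_) (sym nE))))))
        (n+≡ₙ x)))

    label-before : flipLabel (prev x) δ ≡ (x , y)
    label-before rewrite next^-≡ (prev x) 1 1<n xn (suc-prev≡ₙ xn) | next^-≡ (prev x) (3 + δ) (3+<n δ<m) yn before≡ₙ = sortPair-<′ xy

    label-after : flipLabel (prev y) w ≡ (x , y)
    label-after rewrite next^-≡ (prev y) 1 1<n yn (suc-prev≡ₙ yn) | next^-≡ (prev y) (3 + w) (3+<n w<m) xn after≡ₙ = sortPair->′ xy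

    label-cases : ∀ j t → j < n → t < m → flipLabel j t ≡ (x , y) → (j ≡ prev x × t ≡ δ) ⊎ (j ≡ prev y × t ≡ w)
    label-cases j t jn tm eq with sortPair-cases eq
    ... | inj₁ (e1 , e2) = inj₁ (jx , ≡ₙ⇒≡ (<m⇒<n tm) (<m⇒<n δ<m)
            (≡ₙ-cancelˡ {3} (≡ₙ-cancelʳ (prev x) (≡ₙ-trans (subst (λ z → (3 + t + z) ≡ₙ y) jx (next^-≡⁻¹ j (3 + t) e2)) (≡ₙ-sym before≡ₙ)))))
      where jx : j ≡ prev x
            jx = ≡ₙ⇒≡ jn (prev<n xn) (≡ₙ-cancelˡ {1} (≡ₙ-trans (next^-≡⁻¹ j 1 e1) (≡ₙ-sym (suc-prev≡ₙ xn))))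
    ... | inj₂ (e1 , e2) = inj₂ (jy , ≡ₙ⇒≡ (<m⇒<n tm) (<m⇒<n w<m)
            (≡ₙ-cancelˡ {3} (≡ₙ-cancelʳ (prev y) (≡ₙ-trans (subst (λ z → (3 + t + z) ≡ₙ x) jy (next^-≡⁻¹ j (3 + t) e2)) (≡ₙ-sym after≡ₙ)))))
      where jy : j ≡ prev y
            jy = ≡ₙ⇒≡ jn (prev<n yn) (≡ₙ-cancelˡ {1} (≡ₙ-trans (next^-≡⁻¹ j 1 e1) (≡ₙ-sym (suc-prev≡ₙ yn))))

module TwoRainbow (n₀ : ℕ) where
  open Polygon n₀
  open Fans n₀
  open Schedules n₀
  open FanRotation n₀

  ε : ℕ → ℕ
  ε zero = 0
  ε (suc _) = 1

  ε≤1 : ∀ t → ε t ≤ 1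
  ε≤1 zero = z≤n
  ε≤1 (suc t) = ≤-refl

  Fan-ear-ε : ∀ {g} t → 4 ≤ n → 2 ≤ g → HasEar (Fan g t) (ε t) ≡ true
  Fan-ear-ε zero n4 g2 = Fan-ear-0 n4 g2
  Fan-ear-ε (suc t) n4 g2 = Fan-ear-1 n4 (s≤s z≤n)

  HasEar-next^ : ∀ j U {w} → w < n → HasEar (rotate^ j U) (next^ j w) ≡ HasEar U w
  HasEar-next^ j U wn = trans (HasEar-rotate^ j U (next^<n j wn)) (cong (HasEar U) (prev^-next^ j wn))

  module Build₂ (c : ℕ) (ec : n₀ ≡ 2 + c) (c4 : 4 ≤ c) where
    Gc : ℕ
    Gc = 2 + c
    nE : n ≡ 3 + c
    nE = cong suc ec
    Gn : Gc < n
    Gn = subst (Gc <_) (sym nE) ≤-refl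
    n4 : 4 ≤ n
    n4 = subst (4 ≤_) (sym nE) (≤-trans c4 (m≤n+m c 3))

    G3 : 3 ≤ Gc
    G3 = s≤s (s≤s (≤-trans (s≤s z≤n) c4))
    open Schedule n (λ j → j) (λ _ → Gc) (λ _ → G3) (λ _ → Gn)

    stages-chain : ∀ j → j < n → Stage j Gc c ≈ Stage (suc j) Gc 0
    stages-chain j _ = ≈-trans (rotate^-≈ j (FanJoin.Fan-last≈rotate^-Fan-first c 0 e1)) (≈-trans (rotate^-≈ j (rotate^-≈ Gc (FanJoin.Fan-last≈rotate^-Fan-first 0 c ec)))
               (≈-trans (≡⇒≈ (trans (cong (rotate^ j) (rotate^-+ Gc 2 (Fan Gc 0))) (rotate^-+ j (Gc + 2) (Fan Gc 0)))) (rotate^-≡ₙ (Fan Gc 0) md)))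
      where
      e1 : n₀ ≡ 2 + (c + 0)
      e1 = trans ec (cong (2 +_) (sym (+-identityʳ c)))
      S : ∀ j c → j + (2 + c + 2) ≡ suc j + (3 + c)
      S = solve-∀
      md : (j + (Gc + 2)) ≡ₙ suc j
      md = ≡+n⇒≡ₙ (trans (S j c) (cong (suc j +_) (sym nE)))

    stages-close : Stage n Gc 0 ≈ Stage 0 Gc 0
    stages-close = rotate^-≡ₙ {n} {0} (Fan Gc 0) (≡+n⇒≡ₙ (sym (+-identityˡ n)))

    1≡ε : ∀ {t} → 1 ≤ t → 1 ≡ ε t
    1≡ε {suc t} _ = refl

    Fan-ears : ∀ {t w} → t < c → w < n → HasEar (Fan Gc t) w ≡ true → w ≡ ε t ⊎ w ≡ 1 + c
    Fan-ears {t} {w} tc wn e with Fan-ear-cases n4 wn (≤-trans (s≤s (s≤s z≤n)) G3) e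
    ... | inj₁ (refl , refl) = inj₁ refl
    ... | inj₂ (inj₁ (refl , q)) = inj₁ (1≡ε q)
    ... | inj₂ (inj₂ (inj₁ (_ , q))) = ⊥-elim (<⇒≱ (<-≤-trans (n<1+n (3 + c)) (n≤1+n (4 + c))) (subst (_≤ 3 + c) (S7 c) (subst (Gc + 3 ≤_) nE q)))
      where S7 : ∀ c → 2 + c + 3 ≡ 5 + c
            S7 = solve-∀
    ... | inj₂ (inj₂ (inj₂ (inj₁ (q , _ , _)))) = inj₂ (+-cancelʳ-≡ 2 w (1 + c) (trans q (trans nE (S6 c))))
      where S6 : ∀ c → 3 + c ≡ 1 + c + 2
            S6 = solve-∀
    ... | inj₂ (inj₂ (inj₂ (inj₂ (_ , q)))) = ⊥-elim (<⇒≱ (+-monoˡ-< 3 tc) (subst (_≤ t + 3) (+-comm 3 c) (subst (_≤ t + 3) nE q)))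

    -- The ears of Stage j Gc t sit at j + ε t and at j + c + 1; they locate j.
    stages-distinct : ∀ {j t j' t'} → j < n → t < c → j' < n → t' < c → Stage j Gc t ≈ Stage j' Gc t' → j ≡ j' × t ≡ t'
    stages-distinct {j} {t} {j'} {t'} jn tc j'n t'c e = jj , Fan-injective G3 Gn (tG tc) (tG t'c) (rotate^-cancel j (subst (λ z → Stage j Gc t ≈ Stage z Gc t') (sym jj) e))
      where
      tG : ∀ {u} → u < c → 2 + u ≤ Gc
      tG q = s≤s (s≤s (<⇒≤ q))
      c1n : 1 + c < n
      c1n = subst (1 + c <_) (sym nE) (<-trans (n<1+n _) (n<1+n (suc (suc c))))
      epsn : ∀ u → ε u < n
      epsn u = ≤-<-trans (ε≤1 u) (≤-trans (s≤s (s≤s z≤n)) n4)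
      transportEar : ∀ {w} → w < n → HasEar (Fan Gc t) w ≡ true → prev^ j' (next^ j w) ≡ ε t' ⊎ prev^ j' (next^ j w) ≡ 1 + c
      transportEar {w} wn ew = Fan-ears t'c (prev^<n j' (next^<n j wn)) (trans (sym (HasEar-rotate^ j' (Fan Gc t') (next^<n j wn))) (trans (sym (HasEar-≈ e (next^<n j wn))) (trans (HasEar-next^ j (Fan Gc t) wn) ew)))
      S8 : ∀ c → 1 + c + 2 ≡ 3 + c
      S8 = solve-∀
      earLast : HasEar (Fan Gc t) (1 + c) ≡ true
      earLast = Fan-ear-last {Gc} {t} {1 + c} (trans (S8 c) (sym nE)) (n≤1+n _) (s≤s tc)
      earε : HasEar (Fan Gc t) (ε t) ≡ true
      earε = Fan-ear-ε t n4 (≤-trans (s≤s (s≤s z≤n)) G3)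
      rel : ∀ {u w} → u < n → prev^ j' (next^ j u) ≡ w → (w + j') ≡ₙ (u + j)
      rel {u} un refl = prev^-next^-≡ₙ j' j un
      S3 : ∀ e' e j' → e' + e + 2 + j' ≡ (e' + j') + (e + 2)
      S3 = solve-∀
      S4 : ∀ c j e → (1 + c + j) + (e + 2) ≡ (e + j) + (3 + c)
      S4 = solve-∀
      jj : j ≡ j'
      jj with transportEar c1n earLast | transportEar (epsn t) earε
      ... | inj₂ e1 | _ = sym (≡ₙ⇒≡ j'n jn (≡ₙ-cancelˡ (rel c1n e1)))
      ... | inj₁ e1 | inj₁ e2 = ⊥-elim (<⇒≱ (≤-<-trans (ε≤1 t) (s≤s (≤-trans (s≤s z≤n) c4))) (≤-reflexive eq))
        where
        eq : 1 + c ≡ ε t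
        eq = ≡ₙ⇒≡ c1n (epsn t) (≡ₙ-cancelʳ j (≡ₙ-trans (≡ₙ-sym (rel c1n e1)) (rel (epsn t) e2)))
      ... | inj₁ e1 | inj₂ e2 = ⊥-elim (<⇒≱ small (≤-reflexive (sym eq)))
        where
        A : (ε t' + j') ≡ₙ (1 + c + j)
        A = rel c1n e1
        B : (1 + c + j') ≡ₙ (ε t + j)
        B = rel (epsn t) e2
        KK : (ε t' + ε t + 2 + j') ≡ₙ (1 + c + j')
        KK = ≡ₙ-trans (≡⇒≡ₙ (S3 (ε t') (ε t) j')) (≡ₙ-trans (≡ₙ-+ʳ (ε t + 2) A) (≡ₙ-trans (≡⇒≡ₙ (trans (S4 c j (ε t)) (cong ((ε t + j) +_) (sym nE)))) (≡ₙ-trans (n+≡ₙ _) (≡ₙ-sym B))))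
        e3n : ε t' + ε t + 2 < n
        e3n = ≤-trans (s≤s (+-monoˡ-≤ 2 (+-mono-≤ (ε≤1 t') (ε≤1 t)))) (subst (5 ≤_) (sym nE) (s≤s (s≤s (s≤s (≤-trans (s≤s (s≤s z≤n)) c4)))))
        eq : ε t' + ε t + 2 ≡ 1 + c
        eq = ≡ₙ⇒≡ e3n c1n (≡ₙ-cancelʳ j' KK)
        small : ε t' + ε t + 2 < 1 + c
        small = ≤-trans (s≤s (+-monoˡ-≤ 2 (+-mono-≤ (ε≤1 t') (ε≤1 t)))) (s≤s c4)

    labelCounts : Cycle.EachLabelTwice stages-chain stages-close stages-distinct
    labelCounts a b (ab , bn , nb , nt) with ≤⇒∃+ (≤∧≢⇒< ab (≢-sym nb))
    ... | δ , refl with ≤⇒∃+ (gap< a nE bn nt)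
    ...   | w , ew = prev a , δ , prev b , w , (prev<n xn , δ<m) , (prev<n bn , w<m) ,
                     label-before , label-after , runs≢ , label-cases
      where
      open DiagonalLabels {x = a} {δ} {w} nE ew bn
      runs≢ : ¬ (prev a ≡ prev b × δ ≡ w)
      runs≢ (e , _) = <-irrefl (prev-injective xn bn e) ab

    rainbow : RainbowCycle n 2
    rainbow = Cycle.rainbow-twice stages-chain stages-close stages-distinct labelCounts

rainbow₂ : (n : ℕ) → n ≥ 7 → RainbowCycle n 2
rainbow₂ (suc (suc (suc c))) (s≤s (s≤s (s≤s q))) = TwoRainbow.Build₂.rainbow (2 + c) c refl q

module OneRainbow (n₀ : ℕ) where
  open Polygon n₀
  open Fans n₀
  open Schedules n₀
  open FanRotation n₀
  open TwoRainbow n₀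

  module SymmetricFan (k : ℕ) (ek : n ≡ k + k) (k2 : 2 ≤ k) where
    kn : k < n
    kn = subst (k <_) (sym ek) (subst (_≤ k + k) (+-comm k 1) (+-monoʳ-≤ k (≤-trans (s≤s z≤n) k2)))
    prev^-involutive : ∀ {x} → x < n → prev^ k (prev^ k x) ≡ x
    prev^-involutive {x} xn = ≡ₙ⇒≡ (prev^<n k (prev^<n k xn)) xn
      (≡ₙ-trans (≡ₙ-sym (n+≡ₙ _)) (≡ₙ-trans (≡⇒≡ₙ (trans (cong (prev^ k (prev^ k x) +_) ek) (sym (+-assoc (prev^ k (prev^ k x)) k k))))
        (≡ₙ-trans (≡ₙ-+ʳ k (prev^+≡ₙ k (prev^<n k xn))) (prev^+≡ₙ k xn))))
    private
      D1 : ∀ k z → 2 + z + k ≡ 2 + k + z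
      D1 = solve-∀
      D2' : ∀ k z → 3 + k + z ≡ 3 + z + k
      D2' = solve-∀
    InFan-prev^ : ∀ {x y} → x < n → y < n → InFan k 0 x y → InFan± k 0 (prev^ k x) (prev^ k y)
    InFan-prev^ xn yn (inj₁ (_ , q , r)) = ⊥-elim (<-irrefl refl (≤-trans q r))
    InFan-prev^ {x} {y} xn yn (inj₂ (inj₁ (refl , y2 , yk , y2n))) with m≤n⇒m<n∨m≡n yk
    ... | inj₂ refl = subst₂ (InFan± k 0) (sym P0) (sym Pkk) (inj₂ (inj₂ (inj₁ (refl , k2 , ≤-refl , subst (2 + k ≤_) (sym ek) (+-monoˡ-≤ k k2)))))
      where P0 : prev^ k 0 ≡ k
            P0 = prev^-≡ k {0} {k} kn (s≤s z≤n) (≡+n⇒≡ₙ (sym ek))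
            Pkk : prev^ k k ≡ 0
            Pkk = prev^-≡ k {k} {0} (s≤s z≤n) kn (≡⇒≡ₙ refl)
    ... | inj₁ q = subst₂ (InFan± k 0) (sym P0) (sym Py) (inj₁ (inj₂ (inj₂ (refl , +-monoˡ-≤ k y2 , ykn))))
      where P0 : prev^ k 0 ≡ k
            P0 = prev^-≡ k {0} {k} kn (s≤s z≤n) (≡+n⇒≡ₙ (sym ek))
            ykn : y + k < n
            ykn = subst (y + k <_) (sym ek) (+-monoˡ-< k q)
            Py : prev^ k y ≡ y + k
            Py = prev^-≡ k {y} {y + k} ykn yn (≡+n⇒≡ₙ (trans (+-assoc y k k) (cong (y +_) (sym ek))))
    InFan-prev^ {x} {y} xn yn (inj₂ (inj₂ (refl , ky , yn'))) with ≤⇒∃+ ky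
    ... | z , refl = subst₂ (InFan± k 0) (sym Pkk) (sym Py) (inj₁ (inj₂ (inj₁ (refl , m≤m+n 2 z , zk , z4))))
      where Pkk : prev^ k k ≡ 0
            Pkk = prev^-≡ k {k} {0} (s≤s z≤n) kn (≡⇒≡ₙ refl)
            zk' : 3 + z ≤ k
            zk' = +-cancelʳ-≤ k (3 + z) k (subst (_≤ k + k) (D2' k z) (subst (3 + k + z ≤_) ek yn))
            zk : 2 + z ≤ k
            zk = ≤-trans (n≤1+n _) zk'
            z4 : 2 + (2 + z) ≤ n
            z4 = subst (4 + z ≤_) (sym ek) (≤-trans (s≤s zk') (subst (_≤ k + k) (+-comm k 1) (+-monoʳ-≤ k (≤-trans (s≤s z≤n) k2))))
            Py : prev^ k (2 + k + z) ≡ 2 + z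
            Py = prev^-≡ k {2 + k + z} {2 + z} (≤-trans (s≤s (n≤1+n _)) z4) yn (≡⇒≡ₙ (D1 k z))
    Fan-symmetric : Fan k 0 ≈ rotate^ k (Fan k 0)
    Fan-symmetric x y xn yn = trans (Fan-cong (F xn yn) H) (sym (rotate^-prev^ k (Fan k 0) x y))
      where
      F : ∀ {x y} → x < n → y < n → InFan± k 0 x y → InFan± k 0 (prev^ k x) (prev^ k y)
      F xn yn (inj₁ q) = InFan-prev^ xn yn q
      F xn yn (inj₂ q) = InFan±-swap (InFan-prev^ yn xn q)
      H : InFan± k 0 (prev^ k x) (prev^ k y) → InFan± k 0 x y
      H q = subst₂ (InFan± k 0) (prev^-involutive xn) (prev^-involutive yn) (F (prev^<n k xn) (prev^<n k yn) q)

  module Build₁ (α β : ℕ) (hαβ : β ≡ α ⊎ β ≡ suc α) (α1 : 1 ≤ α) (e : n₀ ≡ 2 + (α + β)) where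
    nE : n ≡ 3 + (α + β)
    nE = cong suc e
    β1 : 1 ≤ β
    β1 = [ (λ q → subst (1 ≤_) (sym q) α1) , (λ q → subst (1 ≤_) (sym q) (s≤s z≤n)) ]′ hαβ

    r : ℕ → ℕ
    r zero = 0
    r (suc zero) = 2 + α
    r (suc (suc j)) = suc (r j)
    g : ℕ → ℕ
    g zero = 2 + α
    g (suc zero) = 2 + β
    g (suc (suc j)) = g j

    g3 : ∀ j → 3 ≤ g j
    g3 zero = s≤s (s≤s α1)
    g3 (suc zero) = s≤s (s≤s β1)
    g3 (suc (suc j)) = g3 j
    gn : ∀ j → g j < n
    gn zero = subst (2 + α <_) (sym nE) (s≤s (s≤s (s≤s (m≤m+n α β))))
    gn (suc zero) = subst (2 + β <_) (sym nE) (s≤s (s≤s (s≤s (m≤n+m β α))))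
    gn (suc (suc j)) = gn j

    schedule-even : ∀ i → r (i + i) ≡ i × g (i + i) ≡ 2 + α
    schedule-even zero = refl , refl
    schedule-even (suc i) rewrite +-suc i i = cong suc (proj₁ (schedule-even i)) , proj₂ (schedule-even i)
    schedule-odd : ∀ i → r (suc (i + i)) ≡ (2 + α) + i × g (suc (i + i)) ≡ 2 + β
    schedule-odd zero = cong (2 +_) (sym (+-identityʳ α)) , refl
    schedule-odd (suc i) rewrite +-suc i i = trans (cong suc (proj₁ (schedule-odd i))) (sym (+-suc (2 + α) i)) , proj₂ (schedule-odd i)

    parity : ∀ j → Σ ℕ λ i → (j ≡ i + i) ⊎ (j ≡ suc (i + i))
    parity zero = 0 , inj₁ refl
    parity (suc zero) = 0 , inj₂ refl
    parity (suc (suc j)) with parity j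
    ... | i , inj₁ refl = suc i , inj₁ (cong suc (sym (+-suc i i)))
    ... | i , inj₂ refl = suc i , inj₂ (cong suc (cong suc (sym (+-suc i i))))

    Fan-last≈rotate^-next : ∀ j → Fan (g j) (g j ∸ 2) ≈ rotate^ (g j) (Fan (g (suc j)) 0)
    Fan-last≈rotate^-next zero = FanJoin.Fan-last≈rotate^-Fan-first α β e
    Fan-last≈rotate^-next (suc zero) = FanJoin.Fan-last≈rotate^-Fan-first β α (trans e (cong (2 +_) (+-comm α β)))
    Fan-last≈rotate^-next (suc (suc j)) = Fan-last≈rotate^-next j

    private
      S1 : ∀ α β → (2 + α) + (2 + β) ≡ 1 + (3 + (α + β))
      S1 = solve-∀

    schedule-rotation : ∀ j → (r j + g j) ≡ₙ r (suc j)
    schedule-rotation zero = ≡⇒≡ₙ refl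
    schedule-rotation (suc zero) = ≡+n⇒≡ₙ (trans (S1 α β) (cong (1 +_) (sym nE)))
    schedule-rotation (suc (suc j)) = ≡ₙ-suc (schedule-rotation j)

    open Schedule n r g g3 gn

    stages-chain : ∀ j → j < n → Stage (r j) (g j) (flips j) ≈ Stage (r (suc j)) (g (suc j)) 0
    stages-chain j _ = ≈-trans (rotate^-≈ (r j) (Fan-last≈rotate^-next j)) (≈-trans (≡⇒≈ (rotate^-+ (r j) (g j) _)) (rotate^-≡ₙ _ (schedule-rotation j)))

    private
      S2 : ∀ α → 3 + (α + α) ≡ suc (suc α + suc α)
      S2 = solve-∀
      S3 : ∀ α → 3 + (α + suc α) ≡ (2 + α) + (2 + α)
      S3 = solve-∀
      S4 : ∀ α → 2 + α + suc α ≡ 0 + (3 + (α + α))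
      S4 = solve-∀

    stages-close : Stage (r n) (g n) 0 ≈ Stage (r 0) (g 0) 0
    stages-close = [ odd , even ]′ hαβ
      where
      odd : β ≡ α → Stage (r n) (g n) 0 ≈ Stage (r 0) (g 0) 0
      odd βα = subst (λ m → Stage (r m) (g m) 0 ≈ Fan (2 + α) 0) (sym en) KK
        where
        en : n ≡ suc (suc α + suc α)
        en = trans nE (trans (cong (λ z → 3 + (α + z)) βα) (S2 α))
        KK : Stage (r (suc (suc α + suc α))) (g (suc (suc α + suc α))) 0 ≈ Fan (2 + α) 0
        KK = subst₂ (λ a' b' → rotate^ a' (Fan b' 0) ≈ Fan (2 + α) 0) (sym (proj₁ (schedule-odd (suc α)))) (sym (proj₂ (schedule-odd (suc α)))) (
          subst (λ z → rotate^ (2 + α + suc α) (Fan (2 + z) 0) ≈ Fan (2 + α) 0) (sym βα)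
            (rotate^-≡ₙ {2 + α + suc α} {0} (Fan (2 + α) 0) (≡+n⇒≡ₙ (trans (S4 α) (trans (cong (λ z → 0 + (3 + (α + z))) (sym βα)) (cong (0 +_) (sym nE)))))))
      even : β ≡ suc α → Stage (r n) (g n) 0 ≈ Stage (r 0) (g 0) 0
      even βα = subst (λ m → Stage (r m) (g m) 0 ≈ Fan (2 + α) 0) (sym en) KK
        where
        en : n ≡ (2 + α) + (2 + α)
        en = trans nE (trans (cong (λ z → 3 + (α + z)) βα) (S3 α))
        KK : Stage (r ((2 + α) + (2 + α))) (g ((2 + α) + (2 + α))) 0 ≈ Fan (2 + α) 0
        KK = subst₂ (λ a' b' → rotate^ a' (Fan b' 0) ≈ Fan (2 + α) 0) (sym (proj₁ (schedule-even (2 + α)))) (sym (proj₂ (schedule-even (2 + α)))) (≈-sym (SymmetricFan.Fan-symmetric (2 + α) en (s≤s (s≤s z≤n))))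

    αβ : α ≤ β
    αβ = [ (λ q → ≤-reflexive (sym q)) , (λ q → subst (α ≤_) (sym q) (n≤1+n α)) ]′ hαβ
    βα1 : β ≤ suc α
    βα1 = [ (λ q → subst (_≤ suc α) (sym q) (n≤1+n α)) , (λ q → ≤-reflexive q) ]′ hαβ
    n5 : 5 ≤ n
    n5 = subst (5 ≤_) (sym nE) (s≤s (s≤s (s≤s (+-mono-≤ α1 β1))))
    n4 : 4 ≤ n
    n4 = ≤-trans (n≤1+n 4) n5

    dbl< : ∀ {i k} → i + i < k + k → i < k
    dbl< {i} {k} q with i <? k
    ... | yes p' = p'
    ... | no p' = ⊥-elim (<⇒≱ q (+-mono-≤ (≮⇒≥ p') (≮⇒≥ p')))

    private
      S6 : ∀ α → 3 + (α + suc α) ≡ (2 + α) + (2 + α)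
      S6 = solve-∀
      S7 : ∀ β → 2 + (β + β) ≡ (1 + β) + (1 + β)
      S7 = solve-∀

    schedule-cases : ∀ j → j < n → Σ ℕ λ i → (r j ≡ i × g j ≡ 2 + α × i ≤ 1 + α × j ≡ i + i) ⊎ (r j ≡ (2 + α) + i × g j ≡ 2 + β × i ≤ β × j ≡ suc (i + i))
    schedule-cases j jn with parity j
    ... | i , inj₁ refl = i , inj₁ (proj₁ (schedule-even i) , proj₂ (schedule-even i) , ≤-pred (dbl< lt) , refl)
      where lt : i + i < (2 + α) + (2 + α)
            lt = ≤-trans (subst (i + i <_) nE jn) (≤-trans (+-monoʳ-≤ 3 (+-monoʳ-≤ α βα1)) (≤-reflexive (S6 α)))
    ... | i , inj₂ refl = i , inj₂ (proj₁ (schedule-odd i) , proj₂ (schedule-odd i) , ≤-pred (dbl< lt) , refl)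
      where lt : i + i < (1 + β) + (1 + β)
            lt = ≤-trans (≤-pred (subst (suc (i + i) <_) nE jn)) (≤-trans (+-monoʳ-≤ 2 (+-monoˡ-≤ β αβ)) (≤-reflexive (S7 β)))

    rotation<n : ∀ j → j < n → r j < n
    rotation<n j jn with schedule-cases j jn
    ... | i , inj₁ (e1 , _ , q , _) = subst (_< n) (sym e1) (≤-<-trans q (≤-trans (s≤s (m≤m+n (1 + α) β)) (≤-trans (≤-reflexive refl) (subst (2 + α + β ≤_) (sym nE) (n≤1+n _)))))
    ... | i , inj₂ (e1 , _ , q , _) = subst (_< n) (sym e1) (subst (2 + α + i <_) (sym nE) (s≤s (≤-trans (+-monoʳ-≤ (2 + α) q) (≤-reflexive (+-assoc 2 α β) ))))

    rotation-injective : ∀ {j j'} → j < n → j' < n → r j ≡ r j' → j ≡ j'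
    rotation-injective {j} {j'} jn j'n e with schedule-cases j jn | schedule-cases j' j'n
    ... | i , inj₁ (e1 , _ , q , refl) | i' , inj₁ (e1' , _ , q' , refl) = cong (λ z → z + z) (trans (sym e1) (trans e e1'))
    ... | i , inj₂ (e1 , _ , q , refl) | i' , inj₂ (e1' , _ , q' , refl) = cong (λ z → suc (z + z)) (+-cancelˡ-≡ (2 + α) i i' (trans (sym e1) (trans e e1')))
    ... | i , inj₁ (e1 , _ , q , _) | i' , inj₂ (e1' , _ , q' , _) = ⊥-elim (<⇒≱ (s≤s q) (≤-trans (m≤m+n (2 + α) i') (≤-reflexive (trans (sym e1') (trans (sym e) e1)))))
    ... | i , inj₂ (e1 , _ , q , _) | i' , inj₁ (e1' , _ , q' , _) = ⊥-elim (<⇒≱ (s≤s q') (≤-trans (m≤m+n (2 + α) i) (≤-reflexive (trans (sym e1) (trans e e1')))))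

    g+2≤n : ∀ j → g j + 2 ≤ n
    g+2≤n zero = subst (2 + α + 2 ≤_) (sym nE) (subst (_≤ 3 + (α + β)) (+-comm 2 (2 + α)) (s≤s (s≤s (s≤s (subst (_≤ α + β) (+-comm α 1) (+-monoʳ-≤ α β1))))))
    g+2≤n (suc zero) = subst (2 + β + 2 ≤_) (sym nE) (subst (_≤ 3 + (α + β)) (+-comm 2 (2 + β)) (s≤s (s≤s (s≤s (+-monoˡ-≤ β α1)))))
    g+2≤n (suc (suc j)) = g+2≤n j

    tg : ∀ {j t} → t ≤ flips j → 2 + t ≤ g j
    tg {j} {t} q = lemma (g j) (g3 j) q
      where lemma : ∀ G → 3 ≤ G → t ≤ G ∸ 2 → 2 + t ≤ G
            lemma (suc (suc G)) _ q = s≤s (s≤s q)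
            lemma (suc zero) (s≤s ()) q

    Fan-ears-mid : ∀ {G t w} → 1 ≤ t → 2 + t ≤ G → G + 2 ≤ n → w < n → HasEar (Fan G t) w ≡ true → w ≡ 1 ⊎ w ≡ G
    Fan-ears-mid {G} {t} {w} t1 tG G2 wn ew with Fan-ear-cases n4 wn (≤-trans (s≤s (s≤s z≤n)) tG) ew
    ... | inj₁ (_ , refl) = ⊥-elim (<-irrefl refl t1)
    ... | inj₂ (inj₁ (q , _)) = inj₁ q
    ... | inj₂ (inj₂ (inj₁ (q , _))) = inj₂ q
    ... | inj₂ (inj₂ (inj₂ (inj₁ (q , q2 , _)))) = inj₂ (+-cancelʳ-≡ 2 w G (trans q (≤-antisym q2 G2)))
    ... | inj₂ (inj₂ (inj₂ (inj₂ (_ , q)))) = ⊥-elim (<⇒≱ (≤-trans (s≤s (subst (_≤ G + 1) (T t) (+-monoˡ-≤ 1 tG))) (subst (_≤ n) (+-suc G 1) G2)) q)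
      where T : ∀ t → 2 + t + 1 ≡ t + 3
            T = solve-∀

    1<n : 1 < n
    1<n = ≤-trans (s≤s (s≤s z≤n)) n4

    private
      V1 : ∀ α → 2 + α + (2 + α) ≡ 1 + (3 + (α + α))
      V1 = solve-∀
      V2 : ∀ α → 2 + α + (2 + α) ≡ 0 + (3 + (α + suc α))
      V2 = solve-∀
      V3 : ∀ α β → 2 + α + (2 + β) ≡ 1 + (3 + (α + β))
      V3 = solve-∀
      V4 : ∀ α β → 2 + β + (2 + α) ≡ 1 + (3 + (α + β))
      V4 = solve-∀
      V5 : ∀ α i' → 2 + suc α + (2 + α + i') ≡ (1 + i') + (3 + (α + suc α))
      V5 = solve-∀
      V6 : ∀ α → 3 + α + suc α ≡ 0 + (3 + (α + suc α))
      V6 = solve-∀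

    parity-contradiction : ∀ {j j'} → j < n → j' < n → (g j + g j') ≡ₙ 2 → (g j' + r j') ≡ₙ (1 + r j) → ⊥
    parity-contradiction {j} {j'} jn j'n GG A with schedule-cases j jn | schedule-cases j' j'n
    ... | i , inj₁ (_ , eg , _ , _) | i' , inj₁ (_ , eg' , _ , _) rewrite eg | eg' = [ odd , even ]′ hαβ
      where
      odd : β ≡ α → ⊥
      odd βα = ≡ₙ∧≢⇒⊥ (≡ₙ-trans (≡ₙ-sym (≡+n⇒≡ₙ (trans (V1 α) (trans (cong (λ z → 1 + (3 + (α + z))) (sym βα)) (cong (1 +_) (sym nE)))))) GG) 1<n (≤-trans (s≤s (s≤s (s≤s z≤n))) n4) (λ ())
      even : β ≡ suc α → ⊥
      even βα = ≡ₙ∧≢⇒⊥ (≡ₙ-trans (≡ₙ-sym (≡+n⇒≡ₙ (trans (V2 α) (trans (cong (λ z → 0 + (3 + (α + z))) (sym βα)) (cong (0 +_) (sym nE)))))) GG) (s≤s z≤n) (≤-trans (s≤s (s≤s (s≤s z≤n))) n4) (λ ())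
    ... | i , inj₁ (_ , eg , _ , _) | i' , inj₂ (_ , eg' , _ , _) rewrite eg | eg' =
          ≡ₙ∧≢⇒⊥ (≡ₙ-trans (≡ₙ-sym (≡+n⇒≡ₙ (trans (V3 α β) (cong (1 +_) (sym nE))))) GG) 1<n (≤-trans (s≤s (s≤s (s≤s z≤n))) n4) (λ ())
    ... | i , inj₂ (_ , eg , _ , _) | i' , inj₁ (_ , eg' , _ , _) rewrite eg | eg' =
          ≡ₙ∧≢⇒⊥ (≡ₙ-trans (≡ₙ-sym (≡+n⇒≡ₙ (trans (V4 α β) (cong (1 +_) (sym nE))))) GG) 1<n (≤-trans (s≤s (s≤s (s≤s z≤n))) n4) (λ ())
    ... | i , inj₂ (er , eg , qi , _) | i' , inj₂ (er' , eg' , qi' , _) rewrite eg | eg' | er | er' = [ odd , even ]′ hαβ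
      where
      odd : β ≡ α → ⊥
      odd βα = ≡ₙ∧≢⇒⊥ (≡ₙ-trans (≡ₙ-sym (≡+n⇒≡ₙ (trans (V1 α) (trans (cong (λ z → 1 + (3 + (α + z))) (sym βα)) (cong (1 +_) (sym nE)))))) (subst (λ z → (2 + z + (2 + z)) ≡ₙ 2) βα GG)) 1<n (≤-trans (s≤s (s≤s (s≤s z≤n))) n4) (λ ())
      even : β ≡ suc α → ⊥
      even βα = go (m≤n⇒m<n∨m≡n qi2)
        where
        nE' : n ≡ 3 + (α + suc α)
        nE' = trans nE (cong (λ z → 3 + (α + z)) βα)
        qi2 : i ≤ suc α
        qi2 = subst (i ≤_) βα qi
        qi2' : i' ≤ suc α
        qi2' = subst (i' ≤_) βα qi'
        A2 : (1 + i') ≡ₙ (1 + (2 + α + i))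
        A2 = ≡ₙ-trans (≡ₙ-sym (≡+n⇒≡ₙ (trans (V5 α i') (cong ((1 + i') +_) (sym nE'))))) (subst (λ z → (2 + z + (2 + α + i')) ≡ₙ (1 + (2 + α + i))) βα A)
        i'n : 1 + i' < n
        i'n = subst (1 + i' <_) (sym nE') (s≤s (s≤s (≤-trans qi2' (≤-trans (m≤n+m (suc α) α) (n≤1+n _)))))
        go : i < suc α ⊎ i ≡ suc α → ⊥
        go (inj₁ q) = <⇒≱ (≤-trans (s≤s (s≤s (m≤m+n α i))) (≤-reflexive (sym (suc-injective eq)))) qi2'
          where
          eq : 1 + i' ≡ 1 + (2 + α + i)
          eq = ≡ₙ⇒≡ i'n (subst (3 + α + i <_) (sym nE') (s≤s (s≤s (s≤s (subst (_≤ α + suc α) (+-suc α i) (+-monoʳ-≤ α q)))))) A2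
        go (inj₂ refl) = ≡ₙ∧≢⇒⊥ (≡ₙ-trans A2 (≡+n⇒≡ₙ (trans (V6 α) (cong (0 +_) (sym nE'))))) i'n (s≤s z≤n) (λ ())

    stages-distinct-core : ∀ {j t j' t'} → j < n → j' < n → 1 ≤ t → t ≤ flips j → 1 ≤ t' → t' ≤ flips j' →
           Stage (r j) (g j) t ≈ Stage (r j') (g j') t' → j ≡ j' × t ≡ t'
    stages-distinct-core {j} {t} {j'} {t'} jn j'n t1 tL t1' tL' e = jj , Fan-injective (g3 j) (gn j) (tg {j} tL) (subst (λ z → 2 + t' ≤ g z) (sym jj) (tg {j'} tL'))
                                                        (rotate^-cancel (r j) (subst (λ z → Stage (r j) (g j) t ≈ Stage (r z) (g z) t') (sym jj) e))
      where
      R R' Gj Gj' : ℕ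
      R = r j
      R' = r j'
      Gj = g j
      Gj' = g j'
      transportEar : ∀ {w} → w < n → HasEar (Fan Gj t) w ≡ true → prev^ R' (next^ R w) ≡ 1 ⊎ prev^ R' (next^ R w) ≡ Gj'
      transportEar wn ew = Fan-ears-mid t1' (tg {j'} tL') (g+2≤n j') (prev^<n R' (next^<n R wn)) (trans (sym (HasEar-rotate^ R' (Fan Gj' t') (next^<n R wn))) (trans (sym (HasEar-≈ e (next^<n R wn))) (trans (HasEar-next^ R (Fan Gj t) wn) ew)))
      rel : ∀ {u w} → u < n → prev^ R' (next^ R u) ≡ w → (w + R') ≡ₙ (u + R)
      rel un refl = prev^-next^-≡ₙ R' R un
      jj : j ≡ j'
      jj with transportEar 1<n (Fan-ear-1 n4 t1) | transportEar (gn j) (Fan-ear-g′ (tg {j} tL) (g+2≤n j))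
      ... | inj₁ e1 | _ = rotation-injective jn j'n (sym (≡ₙ⇒≡ (rotation<n j' j'n) (rotation<n j jn) (≡ₙ-cancelˡ {1} (rel 1<n e1))))
      ... | inj₂ e1 | inj₂ e2 = ⊥-elim (≡ₙ∧≢⇒⊥ (≡ₙ-cancelʳ R (≡ₙ-trans (≡ₙ-sym (rel (gn j) e2)) (rel 1<n e1))) (gn j) 1<n (λ q → <-irrefl (sym q) (≤-trans (s≤s (s≤s z≤n)) (g3 j))))
      ... | inj₂ e1 | inj₁ e2 = ⊥-elim (parity-contradiction jn j'n GG A)
        where
        A = rel 1<n e1
        B = rel (gn j) e2
        GG : (Gj + Gj') ≡ₙ 2
        GG = ≡ₙ-cancelʳ R' (≡ₙ-trans (≡⇒≡ₙ (+-assoc Gj Gj' R')) (≡ₙ-trans (≡ₙ-+ˡ Gj A) (≡ₙ-trans (≡⇒≡ₙ (solveA Gj R)) (≡ₙ-trans (≡ₙ-+ˡ 1 (≡ₙ-sym B)) (≡⇒≡ₙ refl)))))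
          where solveA : ∀ G R → G + (1 + R) ≡ 1 + (G + R)
                solveA = solve-∀

    prevRun : ℕ → ℕ
    prevRun zero = n₀
    prevRun (suc j) = j
    prevRun<n : ∀ {j} → j < n → prevRun j < n
    prevRun<n {zero} _ = ≤-refl
    prevRun<n {suc j} q = <-trans ≤-refl q
    prevRun-injective : ∀ {j j'} → j < n → j' < n → prevRun j ≡ prevRun j' → j ≡ j'
    prevRun-injective {zero} {zero} _ _ _ = refl
    prevRun-injective {zero} {suc j'} _ q e = ⊥-elim (<-irrefl (sym e) (≤-pred q))
    prevRun-injective {suc j} {zero} q _ e = ⊥-elim (<-irrefl e (≤-pred q))
    prevRun-injective {suc j} {suc j'} _ _ e = cong suc e
    firstStage≈lastStage : ∀ j → j < n → Stage (r j) (g j) 0 ≈ Stage (r (prevRun j)) (g (prevRun j)) (flips (prevRun j))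
    firstStage≈lastStage zero _ = ≈-sym (≈-trans (stages-chain n₀ ≤-refl) stages-close)
    firstStage≈lastStage (suc j) q = ≈-sym (stages-chain j (<-trans ≤-refl q))

    stages-distinct : ∀ {j t j' t'} → j < n → t < flips j → j' < n → t' < flips j' → Stage (r j) (g j) t ≈ Stage (r j') (g j') t' → j ≡ j' × t ≡ t'
    stages-distinct {j} {zero} {j'} {zero} jn tl j'n t'l e with stages-distinct-core (prevRun<n jn) (prevRun<n j'n) (flips≥1 (prevRun j)) ≤-refl (flips≥1 (prevRun j')) ≤-refl
                                                       (≈-trans (≈-sym (firstStage≈lastStage j jn)) (≈-trans e (firstStage≈lastStage j' j'n)))
    ... | e1 , _ = prevRun-injective jn j'n e1 , refl
    stages-distinct {j} {zero} {j'} {suc t'} jn tl j'n t'l e with stages-distinct-core (prevRun<n jn) j'n (flips≥1 (prevRun j)) ≤-refl (s≤s z≤n) (<⇒≤ t'l) (≈-trans (≈-sym (firstStage≈lastStage j jn)) e)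
    ... | refl , e2 = ⊥-elim (<-irrefl (sym e2) t'l)
    stages-distinct {j} {suc t} {j'} {zero} jn tl j'n t'l e with stages-distinct-core jn (prevRun<n j'n) (s≤s z≤n) (<⇒≤ tl) (flips≥1 (prevRun j')) ≤-refl (≈-trans e (firstStage≈lastStage j' j'n))
    ... | refl , e2 = ⊥-elim (<-irrefl e2 tl)
    stages-distinct {j} {suc t} {j'} {suc t'} jn tl j'n t'l e = stages-distinct-core jn j'n (s≤s z≤n) (<⇒≤ tl) (s≤s z≤n) (<⇒≤ t'l) e

    RunKind : ℕ → ℕ → Set
    RunKind r0 j = (r0 ≤ 1 + α × g j ≡ 2 + α) ⊎ (2 + α ≤ r0 × g j ≡ 2 + β)

    rotation-surjective : ∀ r0 → r0 < n → Σ ℕ λ j → j < n × r j ≡ r0 × RunKind r0 j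
    rotation-surjective r0 r0n with r0 ≤? 1 + α
    ... | yes q = r0 + r0 , jn , proj₁ (schedule-even r0) , inj₁ (q , proj₂ (schedule-even r0))
      where jn : r0 + r0 < n
            jn = subst (r0 + r0 <_) (sym nE) (≤-trans (s≤s (+-mono-≤ q q)) (≤-trans (≤-reflexive (lem α)) (+-monoʳ-≤ 3 (+-monoʳ-≤ α αβ))))
              where
                lem : ∀ α → suc (1 + α + (1 + α)) ≡ 3 + (α + α)
                lem = solve-∀
    ... | no q with ≤⇒∃+ (≰⇒> q)
    ...   | i , refl = suc (i + i) , jn , proj₁ (schedule-odd i) , inj₂ (m≤m+n (2 + α) i , proj₂ (schedule-odd i))
      where
        ib : i ≤ β
        ib = ≤-pred (+-cancelˡ-≤ (2 + α) (suc i) (suc β) (subst (2 + α + suc i ≤_) (lem2 α β) (subst (2 + α + suc i ≤_) nE (subst (_≤ n) (sym (+-suc (2 + α) i)) r0n))))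
          where lem2 : ∀ α β → 3 + (α + β) ≡ 2 + α + suc β
                lem2 = solve-∀
        jn : suc (i + i) < n
        jn = subst (suc (i + i) <_) (sym nE) (s≤s (s≤s (≤-trans (≤-trans (+-mono-≤ ib ib) (+-monoˡ-≤ β βα1)) (≤-reflexive (lem3 α β)))))
          where lem3 : ∀ α β → suc α + β ≡ suc (α + β)
                lem3 = solve-∀

    flips≤β : ∀ j → j < n → flips j ≤ β
    flips≤β j jn with schedule-cases j jn
    ... | _ , inj₁ (_ , eg , _) = subst (_≤ β) (sym (cong (_∸ 2) eg)) αβ
    ... | _ , inj₂ (_ , eg , _) = ≤-reflexive (cong (_∸ 2) eg)

    private
      Y1 : ∀ x' δ w → 3 + (suc δ + w) ≡ (4 + δ) + w
      Y1 = solve-∀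
      Y2 : ∀ x' δ → suc (2 + suc x' + δ) ≡ (4 + δ) + x'
      Y2 = solve-∀

    not-both-β : ∀ x δ w → 2 + x + δ < n → α + β ≡ suc δ + w → suc δ ≤ β → suc w ≤ β → 2 + α ≤ prev x → 2 + α ≤ prev (2 + x + δ) → ⊥
    not-both-β zero δ w _ ew sδ sw _ py = <⇒≱ (s≤s (s≤s (≤-pred (≤-trans sδ βα1)))) py
    not-both-β (suc x') δ w yn ew sδ sw px _ = <⇒≱ (≤-trans px x'w) (≤-trans (≤-pred (≤-trans sw βα1)) (n≤1+n α))
      where
      x'w : x' ≤ w
      x'w = +-cancelˡ-≤ (4 + δ) x' w (subst₂ _≤_ (Y2 x' δ) (trans (trans nE (cong (3 +_) ew)) (Y1 x' δ w)) (subst (suc (2 + suc x' + δ) ≤_) (sym nE) (subst (suc (2 + suc x' + δ) ≤_) nE yn)))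

    not-both-α : ∀ x δ → prev x ≤ 1 + α → prev (2 + x + δ) ≤ 1 + α → α ≤ δ → ⊥
    not-both-α zero δ px _ _ = <⇒≱ (s≤s (s≤s (m≤m+n α β))) (subst (_≤ 1 + α) e px)
    not-both-α (suc x') δ _ py αδ = <⇒≱ (s≤s (s≤s (≤-trans αδ (m≤n+m δ x')))) py

    labelCounts : Cycle.EachLabelOnce stages-chain stages-close stages-distinct
    labelCounts x _ (xy , yn , ny , nt) with ≤⇒∃+ (≤∧≢⇒< xy (≢-sym ny))
    ... | δ , refl with ≤⇒∃+ (gap< x nE yn nt)
    ...   | w , ew with rotation-surjective (prev x) (prev<n (<-trans xy yn)) | rotation-surjective (prev (2 + x + δ)) (prev<n yn)
    ...     | j1 , j1n , rj1 , inf1 | j2 , j2n , rj2 , inf2 = res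
      where
      open DiagonalLabels {x = x} {δ} {w} nE ew yn
      lbl1 : flipLabel (r j1) δ ≡ (x , y)
      lbl1 rewrite rj1 = label-before
      lbl2 : flipLabel (r j2) w ≡ (x , y)
      lbl2 rewrite rj2 = label-after
      uq : ∀ j' t' → j' < n → t' < flips j' → flipLabel (r j') t' ≡ (x , y) → (j' ≡ j1 × t' ≡ δ) ⊎ (j' ≡ j2 × t' ≡ w)
      uq j' t' j'n t'l eq with label-cases (r j') t' (rotation<n j' j'n) (≤-trans t'l (≤-trans (flips≤β j' j'n) (m≤n+m β α))) eq
      ... | inj₁ (rr , e) = inj₁ (rotation-injective j'n j1n (trans rr (sym rj1)) , e)
      ... | inj₂ (rr , e) = inj₂ (rotation-injective j'n j2n (trans rr (sym rj2)) , e)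
      notboth : RunKind (prev x) j1 → RunKind (prev y) j2 → δ < flips j1 → w < flips j2 → ⊥
      notboth (inj₁ (_ , eg1)) _ v1 v2 = <⇒≱ (≤-refl {suc w}) (+-cancelˡ-≤ (suc δ) (suc w) w (subst (suc δ + suc w ≤_) ew
              (+-mono-≤ (subst (suc δ ≤_) (cong (_∸ 2) eg1) v1) (≤-trans v2 (flips≤β j2 j2n)))))
      notboth (inj₂ _) (inj₁ (_ , eg2)) v1 v2 = <⇒≱ (≤-refl {suc w}) (+-cancelˡ-≤ (suc δ) (suc w) w (subst (suc δ + suc w ≤_) (trans (+-comm β α) ew)
              (+-mono-≤ (≤-trans v1 (flips≤β j1 j1n)) (subst (suc w ≤_) (cong (_∸ 2) eg2) v2))))
      notboth (inj₂ (px , eg1)) (inj₂ (py , eg2)) v1 v2 = not-both-β x δ w yn ew (subst (suc δ ≤_) (cong (_∸ 2) eg1) v1) (subst (suc w ≤_) (cong (_∸ 2) eg2) v2) px py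
      one : ¬ (δ < flips j1) → w < flips j2
      one nv = go inf2
        where
        L1δ : flips j1 ≤ δ
        L1δ = ≮⇒≥ nv
        αδ : α ≤ δ
        αδ = [ (λ q → subst (_≤ δ) (cong (_∸ 2) (proj₂ q)) L1δ) , (λ q → ≤-trans αβ (subst (_≤ δ) (cong (_∸ 2) (proj₂ q)) L1δ)) ]′ inf1
        sw : suc w ≤ β
        sw = +-cancelˡ-≤ α (suc w) β (subst (_≤ α + β) (sym (+-suc α w)) (subst (suc α + w ≤_) (sym ew) (+-monoˡ-≤ w (s≤s αδ))))
        go : RunKind (prev y) j2 → w < flips j2
        go (inj₂ (_ , eg2)) = subst (suc w ≤_) (sym (cong (_∸ 2) eg2)) sw
        go (inj₁ (py , eg2)) = subst (suc w ≤_) (sym (cong (_∸ 2) eg2)) ([ (λ βα → subst (suc w ≤_) βα sw) , ev ]′ hαβ)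
          where
          ev : β ≡ suc α → suc w ≤ α
          ev βα with m≤n⇒m<n∨m≡n (subst (suc w ≤_) βα sw)
          ... | inj₁ q = ≤-pred q
          ... | inj₂ q = ⊥-elim (h inf1)
            where
            wα : w ≡ α
            wα = suc-injective q
            δα : δ ≡ α
            δα = suc-injective (+-cancelʳ-≡ α (suc δ) (suc α) (trans (sym (subst (λ z → α + β ≡ suc δ + z) wα ew)) (trans (cong (α +_) βα) (+-comm α (suc α)))))
            h : RunKind (prev x) j1 → ⊥
            h (inj₁ (px , _)) = not-both-α x δ px py αδ
            h (inj₂ (_ , eg1)) = <⇒≱ (≤-reflexive (sym βα)) (subst (β ≤_) δα (subst (_≤ δ) (cong (_∸ 2) eg1) L1δ))
      res : Σ ℕ λ j → Σ ℕ λ t → j < n × t < flips j × flipLabel (r j) t ≡ (x , y) ×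
                     (∀ j' t' → j' < n → t' < flips j' → flipLabel (r j') t' ≡ (x , y) → j' ≡ j × t' ≡ t)
      res with δ <? flips j1
      ... | yes v = j1 , δ , j1n , v , lbl1 , λ j' t' j'n t'l eq → [ (λ q → q) , (λ { (refl , refl) → ⊥-elim (notboth inf1 inf2 v t'l) }) ]′ (uq j' t' j'n t'l eq)
      ... | no nv = j2 , w , j2n , one nv , lbl2 , λ j' t' j'n t'l eq → [ (λ { (refl , refl) → ⊥-elim (nv t'l) }) , (λ q → q) ]′ (uq j' t' j'n t'l eq)

    rainbow : RainbowCycle n 1
    rainbow = Cycle.rainbow-once stages-chain stages-close stages-distinct labelCounts

half : ∀ m → Σ ℕ λ α → (m ≡ α + α) ⊎ (m ≡ α + suc α)
half zero = 0 , inj₁ refl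
half (suc m) with half m
... | α , inj₁ e = α , inj₂ (trans (cong suc e) (sym (+-suc α α)))
... | α , inj₂ e = suc α , inj₁ (cong suc e)

half-positive : ∀ {α β} → β ≤ suc α → 2 ≤ α + β → 1 ≤ α
half-positive {zero} {zero} _ ()
half-positive {zero} {suc zero} _ (s≤s ())
half-positive {zero} {suc (suc β)} (s≤s ()) _
half-positive {suc α} _ _ = s≤s z≤n

rainbow₁-≥5 : (n : ℕ) → n ≥ 5 → RainbowCycle n 1
rainbow₁-≥5 (suc (suc (suc m))) (s≤s (s≤s (s≤s m≥2))) with half m
... | α , inj₁ refl = OneRainbow.Build₁.rainbow (2 + (α + α)) α α (inj₁ refl) (half-positive (n≤1+n α) m≥2) refl
... | α , inj₂ refl = OneRainbow.Build₁.rainbow (2 + (α + suc α)) α (suc α) (inj₂ refl) (half-positive ≤-refl m≥2) refl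

module Square where
  open Polygon 3
  open Fans 3
  open Schedules 3

  below4 : (P : ℕ → Set) → P 0 → P 1 → P 2 → P 3 → ∀ x → x < 4 → P x
  below4 P p0 p1 p2 p3 0 _ = p0
  below4 P p0 p1 p2 p3 1 _ = p1
  below4 P p0 p1 p2 p3 2 _ = p2
  below4 P p0 p1 p2 p3 3 _ = p3
  below4 P p0 p1 p2 p3 (suc (suc (suc (suc x)))) (s≤s (s≤s (s≤s (s≤s ()))))

  agree : Bool → Bool → Bool
  agree true true = true
  agree false false = true
  agree _ _ = false

  agree-sound : ∀ a b → agree a b ≡ true → a ≡ b
  agree-sound true true _ = refl
  agree-sound false false _ = refl

  agreeRow : Edges → Edges → ℕ → Bool
  agreeRow U V x = agree (U x 0) (V x 0) ∧ agree (U x 1) (V x 1) ∧ agree (U x 2) (V x 2) ∧ agree (U x 3) (V x 3)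

  agreeTable : Edges → Edges → Bool
  agreeTable U V = agreeRow U V 0 ∧ agreeRow U V 1 ∧ agreeRow U V 2 ∧ agreeRow U V 3

  agreeRow-sound : ∀ U V x → agreeRow U V x ≡ true → ∀ y → y < 4 → U x y ≡ V x y
  agreeRow-sound U V x e with agree (U x 0) (V x 0) in e0 | agree (U x 1) (V x 1) in e1 | agree (U x 2) (V x 2) in e2 | agree (U x 3) (V x 3) in e3
  ... | true | true | true | true =
    below4 (λ y → U x y ≡ V x y) (agree-sound _ _ e0) (agree-sound _ _ e1) (agree-sound _ _ e2) (agree-sound _ _ e3)

  agreeTable-sound : ∀ U V → agreeTable U V ≡ true → U ≈ V
  agreeTable-sound U V e x y xn yn with agreeRow U V 0 in r0 | agreeRow U V 1 in r1 | agreeRow U V 2 in r2 | agreeRow U V 3 in r3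
  ... | true | true | true | true =
    below4 (λ x → U x y ≡ V x y) (agreeRow-sound U V 0 r0 y yn) (agreeRow-sound U V 1 r1 y yn)
      (agreeRow-sound U V 2 r2 y yn) (agreeRow-sound U V 3 r3 y yn) x xn

  open Schedule 2 (λ j → j) (λ _ → 3) (λ _ → ≤-refl) (λ _ → ≤-refl)

  stages-chain : ∀ j → j < 2 → Stage j 3 1 ≈ Stage (suc j) 3 0
  stages-chain zero _ = agreeTable-sound _ _ refl
  stages-chain (suc zero) _ = agreeTable-sound _ _ refl
  stages-chain (suc (suc j)) (s≤s (s≤s ()))

  stages-close : Stage 2 3 0 ≈ Stage 0 3 0
  stages-close = agreeTable-sound _ _ refl

  stages-distinct : ∀ {j t j' t'} → j < 2 → t < flips j → j' < 2 → t' < flips j' → Stage j 3 t ≈ Stage j' 3 t' → j ≡ j' × t ≡ t'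
  stages-distinct {zero} {zero} {zero} {zero} _ _ _ _ _ = refl , refl
  stages-distinct {suc zero} {zero} {suc zero} {zero} _ _ _ _ _ = refl , refl
  stages-distinct {zero} {zero} {suc zero} {zero} _ _ _ _ e = ⊥-elim (false≢true (sym (e 0 2 (s≤s z≤n) (s≤s (s≤s (s≤s z≤n))))))
  stages-distinct {suc zero} {zero} {zero} {zero} _ _ _ _ e = ⊥-elim (false≢true (e 0 2 (s≤s z≤n) (s≤s (s≤s (s≤s z≤n)))))
  stages-distinct {suc (suc _)} (s≤s (s≤s ())) _ _ _ _
  stages-distinct {_} {_} {suc (suc _)} _ _ (s≤s (s≤s ())) _ _
  stages-distinct {_} {suc _} _ (s≤s ()) _ _ _
  stages-distinct {_} {_} {_} {suc _} _ _ _ (s≤s ()) _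

  labelCounts : Cycle.EachLabelOnce stages-chain stages-close stages-distinct
  labelCounts 0 2 _ = 1 , 0 , ≤-refl , s≤s z≤n , refl , unique
    where unique : ∀ j' t' → j' < 2 → t' < 1 → flipLabel j' t' ≡ (0 , 2) → j' ≡ 1 × t' ≡ 0
          unique 0 0 _ _ ()
          unique 1 0 _ _ _ = refl , refl
          unique (suc (suc _)) _ (s≤s (s≤s ())) _ _
          unique _ (suc _) _ (s≤s ()) _
  labelCounts 1 3 _ = 0 , 0 , s≤s z≤n , s≤s z≤n , refl , unique
    where unique : ∀ j' t' → j' < 2 → t' < 1 → flipLabel j' t' ≡ (1 , 3) → j' ≡ 0 × t' ≡ 0
          unique 0 0 _ _ _ = refl , refl
          unique 1 0 _ _ ()
          unique (suc (suc _)) _ (s≤s (s≤s ())) _ _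
          unique _ (suc _) _ (s≤s ()) _
  labelCounts 0 0 (() , _)
  labelCounts 0 1 (_ , _ , nb , _) = ⊥-elim (nb refl)
  labelCounts 0 3 (_ , _ , _ , nt) = ⊥-elim (nt (refl , refl))
  labelCounts 1 2 (_ , _ , nb , _) = ⊥-elim (nb refl)
  labelCounts 2 3 (_ , _ , nb , _) = ⊥-elim (nb refl)
  labelCounts 0 (suc (suc (suc (suc b)))) (_ , s≤s (s≤s (s≤s (s≤s ()))) , _)
  labelCounts 1 0 (() , _)
  labelCounts 1 1 (s≤s () , _)
  labelCounts 1 (suc (suc (suc (suc b)))) (_ , s≤s (s≤s (s≤s (s≤s ()))) , _)
  labelCounts 2 0 (() , _)
  labelCounts 2 1 (s≤s () , _)
  labelCounts 2 2 (s≤s (s≤s ()) , _)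
  labelCounts 2 (suc (suc (suc (suc b)))) (_ , s≤s (s≤s (s≤s (s≤s ()))) , _)
  labelCounts (suc (suc (suc a))) b (ab , bn , _) = ⊥-elim (<⇒≱ bn (≤-trans (s≤s (s≤s (s≤s (s≤s z≤n)))) ab))

  rainbow : RainbowCycle 4 1
  rainbow = Cycle.rainbow-once stages-chain stages-close stages-distinct labelCounts

rainbow₁ : (n : ℕ) → n ≥ 4 → RainbowCycle n 1
rainbow₁ _ (s≤s (s≤s (s≤s (s≤s {n = zero} z≤n)))) = Square.rainbow
rainbow₁ _ (s≤s (s≤s (s≤s (s≤s {n = suc k} z≤n)))) = rainbow₁-≥5 (5 + k) (s≤s (s≤s (s≤s (s≤s (s≤s z≤n)))))

theorem1 : ((n : ℕ) → n ≥ 4 → RainbowCycle n 1)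
         × ((n : ℕ) → n ≥ 7 → RainbowCycle n 2)
theorem1 = rainbow₁ , rainbow₂
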